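{- Let $\alpha,\beta\in\mathbb{N}$ be relatively prime with $\alpha<\beta$. Then \begin{multline*} \bigl(\alpha\,L(q^{\alpha})-\beta\,L(q^{\beta})\bigr)^{2}=(\alpha-\beta)^{2}+\sum_{n=1}^{\infty}\Bigl(240\,\alpha^{2}\,\sigma_{3}(\tfrac{n}{\alpha})+240\,\beta^{2}\,\sigma_{3}(\tfrac{n}{\beta})\\ +48\,\alpha\,(\beta-6n)\,\sigma(\tfrac{n}{\alpha})+48\,\beta\,(\alpha-6n)\,\sigma(\tfrac{n}{\beta})-1152\,\alpha\beta\,W_{(\alpha,\beta)}(n)\Bigr)q^{n}. \end{multline*}
   Context: For $k,n\in\mathbb{N}$, $\sigma_{k}(n)=\sum_{0<d\mid n}d^{k}$, $\sigma(n)=\sigma_1(n)$, and $\sigma_k(x)=0$ whenever $x\notin\mathbb{N}$ (in particular $\sigma(0)=0$ and $\sigma(n/\alpha)=0$ if $\alpha\nmid n$). For $\alpha\le\beta$ in $\mathbb{N}$ and $n\in\mathbb{N}$, the convolution sum is $W_{(\alpha,\beta)}(n)=\sum_{(l,m)\in\mathbb{N}_0^{2},\ \alpha l+\beta m=n}\sigma(l)\sigma(m)$. Here $q=e^{2\pi i z}$ with $z$ in the upper half-plane, $L(q)=1-24\sum_{n\ge1}\sigma(n)q^{n}$, and $L(q^{t})$ is $L$ evaluated at $q^{t}$. -}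

module Defs where

open import Data.Nat as ℕ using (ℕ; zero; suc; _^_; _∸_)
open import Data.Nat.Divisibility using (_∣?_)
open import Data.Nat.DivMod using (_/_)
open import Data.Integer as ℤ using (ℤ; +_; -_; _+_; _-_; _*_)
open import Relation.Nullary using (yes; no)

sumTo : ℕ → (ℕ → ℤ) → ℤ
sumTo zero    f = f 0
sumTo (suc n) f = sumTo n f + f (suc n)

sumToℕ : ℕ → (ℕ → ℕ) → ℕ
sumToℕ zero    f = f 0
sumToℕ (suc n) f = sumToℕ n f ℕ.+ f (suc n)

σₖ : ℕ → ℕ → ℕ
σₖ k zero    = 0
σₖ k (suc n) = sumToℕ (suc n) term
  where
  term : ℕ → ℕ
  term zero    = 0
  term (suc d) with suc d ∣? suc n
  ... | yes _ = suc d ^ k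
  ... | no  _ = 0

σ : ℕ → ℕ
σ = σₖ 1

-- σ_k(n/a), which is 0 when a ∤ n (a ≥ 1; the value for a = 0 is irrelevant)
σₖ/ : ℕ → ℕ → ℕ → ℕ
σₖ/ k n zero    = 0
σₖ/ k n (suc a) with suc a ∣? n
... | yes _ = σₖ k (n / suc a)
... | no  _ = 0

-- W_{(α,β)}(n) = Σ_{(l,m) ∈ ℕ₀², αl+βm=n} σ(l)σ(m)
-- (for α,β ≥ 1 any such l,m satisfy l,m ≤ n)
W : ℕ → ℕ → ℕ → ℕ
W α β n = sumToℕ n (λ l → sumToℕ n (λ m → pick l m))
  where
  pick : ℕ → ℕ → ℕ
  pick l m with α ℕ.* l ℕ.+ β ℕ.* m ℕ.≟ n
  ... | yes _ = σ l ℕ.* σ m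
  ... | no  _ = 0

-- Formal power series in q with integer coefficients: coefficient sequences.
PS : Set
PS = ℕ → ℤ

infixl 6 _⊖_
infixl 7 _·_ _⊗_

_⊖_ : PS → PS → PS
(f ⊖ g) n = f n - g n

_·_ : ℤ → PS → PS
(c · f) n = c * f n

_⊗_ : PS → PS → PS
(f ⊗ g) n = sumTo n (λ i → f i * g (n ∸ i))

-- f(q^t): coefficient of q^n is f_{n/t} if t ∣ n, else 0  (t ≥ 1)
atPow : ℕ → PS → PS
atPow zero    f n = + 0
atPow (suc t) f n with suc t ∣? n
... | yes _ = f (n / suc t)
... | no  _ = + 0

L : PS
L zero    = + 1
L (suc n) = - (+ 24 * + σ (suc n))

rhs : ℕ → ℕ → PS
rhs α β zero = (+ α - + β) * (+ α - + β)
rhs α β n@(suc _) =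
    + 240 * + (α ^ 2) * + σₖ/ 3 n α
  + + 240 * + (β ^ 2) * + σₖ/ 3 n β
  + + 48 * + α * (+ β - + 6 * + n) * + σₖ/ 1 n α
  + + 48 * + β * (+ α - + 6 * + n) * + σₖ/ 1 n β
  - + 1152 * + α * + β * + W α β n

-- Expanding the square, the coefficient of q^n is a combination of σ(n/α), σ(n/β), the
-- self-convolutions of σ(·/α) and of σ(·/β), and the mixed convolution, which is W_(α,β)(n).
-- The self-convolution of σ(·/α) at n is Σ_{k ≤ m} σ(k)σ(m−k) with m = n/α, which is given
-- by Besge's formula 12 Σ σ(k)σ(m−k) = 5σ₃(m) + (1 − 6m)σ(m).
--
-- Besge's formula is proved by counting: Σ σ(k)σ(m−k) = Σ_{a,b} ab N(a,b), where N(a,b)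
-- counts the 0 < k < m with a ∣ k and b ∣ m − k. Split each count by the sign of
-- bk − a(m−k): the part of N(u,v) with bk < a(m−k) is in bijection with all of N(u+v,v),
-- and symmetrically for >. Doing this for the weights ab, a² and b² gives a linear system
-- that determines Σ ab N(a,b) from the diagonal counts N(a,a) = [a ∣ m](m/a − 1) and the
-- boundary counts (bk = a(m−k) has a solution exactly when a+b ∣ m), both divisor sums.
module Submission where

open import Defs
open import Data.Nat as ℕ using (ℕ; zero; suc; _∸_; _^_; _≤_; _<_; _⊓_; z≤n; s≤s; _≤?_; _<?_)
import Data.Nat.Properties as ℕₚ
open import Data.Nat.Coprimality using (Coprime)
open import Data.Nat.Divisibility
open import Data.Nat.DivMod using (_/_; m*n/n≡m)
open import Data.Integer as ℤ using (ℤ; +_; -_; _+_; _-_; _*_; 0ℤ; 1ℤ)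
import Data.Integer.Properties as ℤₚ
open import Data.Integer.Tactic.RingSolver using (solve-∀)
open import Data.Empty using (⊥-elim)
open import Data.Product using (_×_; _,_; proj₁; proj₂)
open import Function using (_∘_)
open import Relation.Binary.Definitions using (tri<; tri≈; tri>)
open import Relation.Binary.PropositionalEquality
open import Relation.Nullary using (Dec; yes; no; ¬_)
open import Relation.Nullary.Decidable using (_×-dec_)
open import Algebra.Properties.CommutativeSemigroup ℕₚ.*-commutativeSemigroup
  using () renaming (x∙yz≈y∙xz to *-left-comm)
open import Algebra.Properties.CommutativeSemigroup ℕₚ.+-commutativeSemigroup
  using () renaming (x∙yz≈y∙xz to +-left-comm)

-- Finite sums

sum-cong : ∀ n {f g : ℕ → ℤ} → (∀ i → i ≤ n → f i ≡ g i) → sumTo n f ≡ sumTo n g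
sum-cong zero    f≗g = f≗g 0 z≤n
sum-cong (suc n) f≗g =
  cong₂ _+_ (sum-cong n (λ i i≤n → f≗g i (ℕₚ.m≤n⇒m≤1+n i≤n))) (f≗g (suc n) ℕₚ.≤-refl)

sum-+ : ∀ n (f g : ℕ → ℤ) → sumTo n (λ i → f i + g i) ≡ sumTo n f + sumTo n g
sum-+ zero    f g = refl
sum-+ (suc n) f g =
  trans (cong (_+ (f (suc n) + g (suc n))) (sum-+ n f g)) (interchange (sumTo n f) (sumTo n g) (f (suc n)) (g (suc n)))
  where
  interchange : ∀ a b c d → (a + b) + (c + d) ≡ (a + c) + (b + d)
  interchange = solve-∀

sum-*ˡ : ∀ n c (f : ℕ → ℤ) → sumTo n (λ i → c * f i) ≡ c * sumTo n f
sum-*ˡ zero    c f = refl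
sum-*ˡ (suc n) c f = trans (cong (_+ c * f (suc n)) (sum-*ˡ n c f)) (sym (ℤₚ.*-distribˡ-+ c _ _))

sum-*ʳ : ∀ n (f : ℕ → ℤ) c → sumTo n (λ i → f i * c) ≡ sumTo n f * c
sum-*ʳ n f c =
  trans (sum-cong n (λ i _ → ℤₚ.*-comm (f i) c)) (trans (sum-*ˡ n c f) (ℤₚ.*-comm c _))

sum-zero : ∀ n (f : ℕ → ℤ) → (∀ i → i ≤ n → f i ≡ 0ℤ) → sumTo n f ≡ 0ℤ
sum-zero n f f≡0 = trans (sum-cong n f≡0) (sum-0 n)
  where
  sum-0 : ∀ n → sumTo n (λ _ → 0ℤ) ≡ 0ℤ
  sum-0 zero    = refl
  sum-0 (suc n) = cong (_+ 0ℤ) (sum-0 n)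

sum-extend : ∀ n m (f : ℕ → ℤ) → n ≤ m → (∀ i → n < i → f i ≡ 0ℤ) → sumTo m f ≡ sumTo n f
sum-extend n m f n≤m f≡0 = trans (cong (λ k → sumTo k f) (sym (ℕₚ.m∸n+n≡m n≤m))) (pad (m ∸ n))
  where
  pad : ∀ k → sumTo (k ℕ.+ n) f ≡ sumTo n f
  pad zero    = refl
  pad (suc k) = trans (cong₂ _+_ (pad k) (f≡0 (suc (k ℕ.+ n)) (s≤s (ℕₚ.m≤n+m n k)))) (ℤₚ.+-identityʳ _)

sum-swap : ∀ n m (f : ℕ → ℕ → ℤ) →
  sumTo n (λ i → sumTo m (λ j → f i j)) ≡ sumTo m (λ j → sumTo n (λ i → f i j))
sum-swap zero    m f = refl
sum-swap (suc n) m f = trans (cong (_+ sumTo m (f (suc n))) (sum-swap n m f)) (sym (sum-+ m _ _))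

sum-unfoldˡ : ∀ n (f : ℕ → ℤ) → sumTo (suc n) f ≡ f 0 + sumTo n (λ i → f (suc i))
sum-unfoldˡ zero    f = refl
sum-unfoldˡ (suc n) f = trans (cong (_+ f (suc (suc n))) (sum-unfoldˡ n f)) (ℤₚ.+-assoc (f 0) _ _)

sum-reflect : ∀ n (f : ℕ → ℤ) → sumTo n f ≡ sumTo n (λ i → f (n ∸ i))
sum-reflect zero    f = refl
sum-reflect (suc n) f = trans (cong (_+ f (suc n)) (sum-reflect n f))
  (trans (ℤₚ.+-comm _ (f (suc n))) (sym (sum-unfoldˡ n (λ i → f (suc n ∸ i)))))

sum-single : ∀ n k (f : ℕ → ℤ) → k ≤ n → (∀ i → i ≤ n → i ≢ k → f i ≡ 0ℤ) → sumTo n f ≡ f k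
sum-single zero .zero f z≤n f≡0 = refl
sum-single (suc n) k f k≤ f≡0 with k ℕ.≟ suc n
... | yes refl = trans (cong (_+ f (suc n)) (sum-zero n f below)) (ℤₚ.+-identityˡ _)
  where
  below : ∀ i → i ≤ n → f i ≡ 0ℤ
  below i i≤n = f≡0 i (ℕₚ.m≤n⇒m≤1+n i≤n) (λ { refl → ℕₚ.<-irrefl refl (s≤s i≤n) })
... | no k≢ = trans (cong₂ _+_ (sum-single n k f (ℕₚ.≤-pred (ℕₚ.≤∧≢⇒< k≤ k≢)) below) top)
                    (ℤₚ.+-identityʳ _)
  where
  below : ∀ i → i ≤ n → i ≢ k → f i ≡ 0ℤ
  below i i≤n = f≡0 i (ℕₚ.m≤n⇒m≤1+n i≤n)
  top : f (suc n) ≡ 0ℤ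
  top = f≡0 (suc n) ℕₚ.≤-refl (λ e → k≢ (sym e))

sum-− : ∀ n (f g : ℕ → ℤ) → sumTo n (λ i → f i - g i) ≡ sumTo n f - sumTo n g
sum-− zero    f g = refl
sum-− (suc n) f g =
  trans (cong (_+ (f (suc n) - g (suc n))) (sum-− n f g)) (interchange (sumTo n f) (sumTo n g) (f (suc n)) (g (suc n)))
  where
  interchange : ∀ a b c d → (a - b) + (c - d) ≡ (a + c) - (b + d)
  interchange = solve-∀

𝟙 : {P : Set} → Dec P → ℤ
𝟙 (yes _) = 1ℤ
𝟙 (no _)  = 0ℤ

𝟙-yes : ∀ {P : Set} (d : Dec P) → P → 𝟙 d ≡ 1ℤ
𝟙-yes (yes _) p = refl
𝟙-yes (no ¬p) p = ⊥-elim (¬p p)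

𝟙-no : ∀ {P : Set} (d : Dec P) → ¬ P → 𝟙 d ≡ 0ℤ
𝟙-no (yes p) ¬p = ⊥-elim (¬p p)
𝟙-no (no _)  ¬p = refl

𝟙-⇔ : ∀ {P Q : Set} (d : Dec P) (e : Dec Q) → (P → Q) → (Q → P) → 𝟙 d ≡ 𝟙 e
𝟙-⇔ (yes p) e f g = sym (𝟙-yes e (f p))
𝟙-⇔ (no ¬p) e f g = sym (𝟙-no e (λ q → ¬p (g q)))

𝟙-× : ∀ {P Q : Set} (d : Dec P) (e : Dec Q) → 𝟙 (d ×-dec e) ≡ 𝟙 d * 𝟙 e
𝟙-× (yes p) (yes q) = refl
𝟙-× (yes p) (no ¬q) = refl
𝟙-× (no ¬p) e       = refl

𝟙*-yes : ∀ {P : Set} (d : Dec P) → P → ∀ x → 𝟙 d * x ≡ x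
𝟙*-yes d p x = trans (cong (_* x) (𝟙-yes d p)) (ℤₚ.*-identityˡ x)

𝟙*-no : ∀ {P : Set} (d : Dec P) → ¬ P → ∀ x → 𝟙 d * x ≡ 0ℤ
𝟙*-no d ¬p x = trans (cong (_* x) (𝟙-no d ¬p)) (ℤₚ.*-zeroˡ x)

sum-𝟙≟ : ∀ n k (f : ℕ → ℤ) → k ≤ n → sumTo n (λ i → 𝟙 (i ℕ.≟ k) * f i) ≡ f k
sum-𝟙≟ n k f k≤n =
  trans (sum-single n k _ k≤n (λ i _ i≢k → 𝟙*-no (i ℕ.≟ k) i≢k (f i))) (𝟙*-yes (k ℕ.≟ k) refl (f k))

𝟙-trichotomy : ∀ x y → 𝟙 (x <? y) + 𝟙 (x ℕ.≟ y) + 𝟙 (y <? x) ≡ 1ℤ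
𝟙-trichotomy x y with ℕₚ.<-cmp x y
... | tri< a ¬b ¬c = cong₂ _+_ (cong₂ _+_ (𝟙-yes (x <? y) a) (𝟙-no (x ℕ.≟ y) ¬b)) (𝟙-no (y <? x) ¬c)
... | tri≈ ¬a b ¬c = cong₂ _+_ (cong₂ _+_ (𝟙-no (x <? y) ¬a) (𝟙-yes (x ℕ.≟ y) b)) (𝟙-no (y <? x) ¬c)
... | tri> ¬a ¬b c = cong₂ _+_ (cong₂ _+_ (𝟙-no (x <? y) ¬a) (𝟙-no (x ℕ.≟ y) ¬b)) (𝟙-yes (y <? x) c)

𝟙-split₃ : ∀ {P : Set} (c : Dec P) x y →
  𝟙 c ≡ 𝟙 (c ×-dec (x <? y)) + 𝟙 (c ×-dec (x ℕ.≟ y)) + 𝟙 (c ×-dec (y <? x))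
𝟙-split₃ c x y = sym (begin
    𝟙 (c ×-dec (x <? y)) + 𝟙 (c ×-dec (x ℕ.≟ y)) + 𝟙 (c ×-dec (y <? x))
  ≡⟨ cong₂ _+_ (cong₂ _+_ (𝟙-× c (x <? y)) (𝟙-× c (x ℕ.≟ y))) (𝟙-× c (y <? x)) ⟩
    𝟙 c * 𝟙 (x <? y) + 𝟙 c * 𝟙 (x ℕ.≟ y) + 𝟙 c * 𝟙 (y <? x)
  ≡⟨ factor (𝟙 c) (𝟙 (x <? y)) (𝟙 (x ℕ.≟ y)) (𝟙 (y <? x)) ⟩
    𝟙 c * (𝟙 (x <? y) + 𝟙 (x ℕ.≟ y) + 𝟙 (y <? x))
  ≡⟨ cong (𝟙 c *_) (𝟙-trichotomy x y) ⟩
    𝟙 c * 1ℤ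
  ≡⟨ ℤₚ.*-identityʳ _ ⟩
    𝟙 c ∎)
  where
  open ≡-Reasoning
  factor : ∀ a b d e → a * b + a * d + a * e ≡ a * (b + d + e)
  factor = solve-∀

sum-𝟙-interval : ∀ n p → sumTo n (λ x → 𝟙 (1 ≤? x ×-dec x ≤? p)) ≡ + (n ⊓ p)
sum-𝟙-interval zero    p = refl
sum-𝟙-interval (suc n) p with suc n ≤? p
... | yes n<p = trans (cong (_+ 1ℤ) (sum-𝟙-interval n p))
    (trans (cong (λ t → + t + 1ℤ) (ℕₚ.m≤n⇒m⊓n≡m (ℕₚ.<⇒≤ n<p)))
      (trans (sym (ℤₚ.pos-+ n 1)) (cong +_ (trans (ℕₚ.+-comm n 1) (sym (ℕₚ.m≤n⇒m⊓n≡m n<p))))))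
... | no n≮p = trans (cong (_+ 0ℤ) (sum-𝟙-interval n p))
    (trans (ℤₚ.+-identityʳ _) (cong +_ (trans (ℕₚ.m≥n⇒m⊓n≡n p≤n) (sym (ℕₚ.m≥n⇒m⊓n≡n (ℕₚ.m≤n⇒m≤1+n p≤n))))))
  where
  p≤n : p ≤ n
  p≤n = ℕₚ.≤-pred (ℕₚ.≰⇒> n≮p)

sum-multiples : ∀ c M (F : ℕ → ℤ) →
  sumTo M (λ k → 𝟙 (suc c ∣? k) * F k) ≡ sumTo M (λ x → 𝟙 (suc c ℕ.* x ≤? M) * F (suc c ℕ.* x))
sum-multiples c M F = sym (begin
    sumTo M (λ x → 𝟙 (c′ ℕ.* x ≤? M) * F (c′ ℕ.* x))
  ≡⟨ sum-cong M (λ x _ → sym (pick-multiple x)) ⟩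
    sumTo M (λ x → sumTo M (λ k → 𝟙 (k ℕ.≟ c′ ℕ.* x) * F k))
  ≡⟨ sum-swap M M _ ⟩
    sumTo M (λ k → sumTo M (λ x → 𝟙 (k ℕ.≟ c′ ℕ.* x) * F k))
  ≡⟨ sum-cong M (λ k k≤M → trans (sum-*ʳ M (λ x → 𝟙 (k ℕ.≟ c′ ℕ.* x)) (F k)) (cong (_* F k) (count-quotients k k≤M))) ⟩
    sumTo M (λ k → 𝟙 (c′ ∣? k) * F k) ∎)
  where
  open ≡-Reasoning
  c′ = suc c
  pick-multiple : ∀ x → sumTo M (λ k → 𝟙 (k ℕ.≟ c′ ℕ.* x) * F k) ≡ 𝟙 (c′ ℕ.* x ≤? M) * F (c′ ℕ.* x)
  pick-multiple x with c′ ℕ.* x ≤? M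
  ... | yes c′x≤M = trans (sum-single M (c′ ℕ.* x) _ c′x≤M (λ i _ i≢ → 𝟙*-no (i ℕ.≟ c′ ℕ.* x) i≢ (F i)))
                          (trans (𝟙*-yes (c′ ℕ.* x ℕ.≟ c′ ℕ.* x) refl _) (sym (ℤₚ.*-identityˡ _)))
  ... | no c′x≰M = trans (sum-zero M _ (λ i i≤M → 𝟙*-no (i ℕ.≟ c′ ℕ.* x) (λ e → c′x≰M (subst (_≤ M) e i≤M)) (F i)))
                         (sym (ℤₚ.*-zeroˡ (F (c′ ℕ.* x))))
  count-quotients : ∀ k → k ≤ M → sumTo M (λ x → 𝟙 (k ℕ.≟ c′ ℕ.* x)) ≡ 𝟙 (c′ ∣? k)
  count-quotients k k≤M with c′ ∣? k
  ... | yes (divides q k≡qc′) =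
    trans (sum-single M q _ q≤M (λ i _ i≢q → 𝟙-no (k ℕ.≟ c′ ℕ.* i) (λ e → i≢q (ℕₚ.*-cancelˡ-≡ i q c′ (trans (sym e) k≡c′q)))))
          (𝟙-yes (k ℕ.≟ c′ ℕ.* q) k≡c′q)
    where
    k≡c′q : k ≡ c′ ℕ.* q
    k≡c′q = trans k≡qc′ (ℕₚ.*-comm q c′)
    q≤M : q ≤ M
    q≤M = ℕₚ.≤-trans (ℕₚ.m≤m*n q c′) (ℕₚ.≤-trans (ℕₚ.≤-reflexive (sym k≡qc′)) k≤M)
  ... | no c′∤k = sum-zero M _ (λ i _ → 𝟙-no (k ℕ.≟ c′ ℕ.* i) (λ e → c′∤k (divides i (trans e (ℕₚ.*-comm c′ i)))))

sum-shift : ∀ M b (H : ℕ → ℤ) → (∀ i → M < i → H i ≡ 0ℤ) →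
  sumTo M (λ a → 𝟙 (b <? a) * H a) ≡ sumTo M (λ u → 𝟙 (1 ≤? u) * H (b ℕ.+ u))
sum-shift M b H H≡0 = trans (sym (sum-extend M (b ℕ.+ M) _ (ℕₚ.m≤n+m M b) vanish)) (shifted M)
  where
  vanish : ∀ i → M < i → 𝟙 (b <? i) * H i ≡ 0ℤ
  vanish i M<i = trans (cong (𝟙 (b <? i) *_) (H≡0 i M<i)) (ℤₚ.*-zeroʳ (𝟙 (b <? i)))
  shifted : ∀ K → sumTo (b ℕ.+ K) (λ a → 𝟙 (b <? a) * H a) ≡ sumTo K (λ u → 𝟙 (1 ≤? u) * H (b ℕ.+ u))
  shifted zero = trans (sum-zero (b ℕ.+ 0) _ (λ i i≤b → 𝟙*-no (b <? i) (ℕₚ.≤⇒≯ (ℕₚ.≤-trans i≤b (ℕₚ.≤-reflexive (ℕₚ.+-identityʳ b)))) (H i)))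
                       (sym (ℤₚ.*-zeroˡ (H (b ℕ.+ 0))))
  shifted (suc K) = trans (cong (λ t → sumTo t (λ a → 𝟙 (b <? a) * H a)) (ℕₚ.+-suc b K))
    (cong₂ _+_ (shifted K)
      (trans (𝟙*-yes (b <? suc (b ℕ.+ K)) (s≤s (ℕₚ.m≤m+n b K)) (H (suc (b ℕ.+ K))))
        (trans (cong H (sym (ℕₚ.+-suc b K))) (sym (𝟙*-yes (1 ≤? suc K) (s≤s z≤n) (H (b ℕ.+ suc K)))))))

sum-interior : ∀ t (f : ℕ → ℤ) →
  sumTo (suc t) (λ u → 𝟙 (1 ≤? u) * (𝟙 (u <? suc t) * f u)) ≡ sumTo (suc t) f - f 0 - f (suc t)
sum-interior t f = begin
    sumTo s (λ u → 𝟙 (1 ≤? u) * (𝟙 (u <? s) * f u))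
  ≡⟨ sum-cong s (λ u u≤s → interior u u≤s (f u)) ⟩
    sumTo s (λ u → (f u - 𝟙 (u ℕ.≟ 0) * f u) - 𝟙 (u ℕ.≟ s) * f u)
  ≡⟨ trans (sum-− s _ _) (cong (_- sumTo s (λ u → 𝟙 (u ℕ.≟ s) * f u)) (sum-− s _ _)) ⟩
    sumTo s f - sumTo s (λ u → 𝟙 (u ℕ.≟ 0) * f u) - sumTo s (λ u → 𝟙 (u ℕ.≟ s) * f u)
  ≡⟨ cong₂ (λ a b → sumTo s f - a - b) (sum-𝟙≟ s 0 f z≤n) (sum-𝟙≟ s s f ℕₚ.≤-refl) ⟩
    sumTo s f - f 0 - f s ∎
  where
  open ≡-Reasoning
  s = suc t
  interior : ∀ u → u ≤ s → ∀ x → 𝟙 (1 ≤? u) * (𝟙 (u <? s) * x) ≡ x - 𝟙 (u ℕ.≟ 0) * x - 𝟙 (u ℕ.≟ s) * x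
  interior zero    _   x = left x
    where
    left : ∀ x → 0ℤ ≡ x - 1ℤ * x - 0ℤ * x
    left = solve-∀
  interior (suc u) u<s x with suc u ℕ.≟ s
  ... | yes u≡s = trans (cong (λ i → 1ℤ * (i * x)) (𝟙-no (suc u <? s) (ℕₚ.<-irrefl u≡s))) (right x)
    where
    right : ∀ x → 1ℤ * (0ℤ * x) ≡ x - 0ℤ * x - 1ℤ * x
    right = solve-∀
  ... | no u≢s = trans (cong (λ i → 1ℤ * (i * x)) (𝟙-yes (suc u <? s) (ℕₚ.≤∧≢⇒< u<s u≢s))) (middle x)
    where
    middle : ∀ x → 1ℤ * (1ℤ * x) ≡ x - 0ℤ * x - 0ℤ * x
    middle = solve-∀

-- Besge's formula

pos-suc : ∀ n → + suc n ≡ + n + 1ℤ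
pos-suc n = trans (cong +_ (ℕₚ.+-comm 1 n)) (ℤₚ.pos-+ n 1)

sum-1 : ∀ n → sumTo n (λ _ → 1ℤ) ≡ + n + 1ℤ
sum-1 zero    = refl
sum-1 (suc n) = cong (_+ 1ℤ) (trans (sum-1 n) (sym (pos-suc n)))

sum-id : ∀ n → + 2 * sumTo n (λ u → + u) ≡ + n * (+ n + 1ℤ)
sum-id zero    = refl
sum-id (suc n) = begin
    + 2 * (sumTo n (λ u → + u) + + suc n)
  ≡⟨ ℤₚ.*-distribˡ-+ (+ 2) (sumTo n (λ u → + u)) (+ suc n) ⟩
    + 2 * sumTo n (λ u → + u) + + 2 * + suc n
  ≡⟨ cong₂ (λ a b → a + + 2 * b) (sum-id n) (pos-suc n) ⟩
    + n * (+ n + 1ℤ) + + 2 * (+ n + 1ℤ)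
  ≡⟨ step (+ n) ⟩
    (+ n + 1ℤ) * ((+ n + 1ℤ) + 1ℤ)
  ≡⟨ cong (λ x → x * (x + 1ℤ)) (sym (pos-suc n)) ⟩
    + suc n * (+ suc n + 1ℤ) ∎
  where
  open ≡-Reasoning
  step : ∀ x → x * (x + 1ℤ) + + 2 * (x + 1ℤ) ≡ (x + 1ℤ) * ((x + 1ℤ) + 1ℤ)
  step = solve-∀

sum-square : ∀ n → + 6 * sumTo n (λ u → + u * + u) ≡ + n * (+ n + 1ℤ) * (+ 2 * + n + 1ℤ)
sum-square zero    = refl
sum-square (suc n) = begin
    + 6 * (sumTo n (λ u → + u * + u) + + suc n * + suc n)
  ≡⟨ ℤₚ.*-distribˡ-+ (+ 6) (sumTo n (λ u → + u * + u)) (+ suc n * + suc n) ⟩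
    + 6 * sumTo n (λ u → + u * + u) + + 6 * (+ suc n * + suc n)
  ≡⟨ cong₂ (λ a b → a + + 6 * (b * b)) (sum-square n) (pos-suc n) ⟩
    + n * (+ n + 1ℤ) * (+ 2 * + n + 1ℤ) + + 6 * ((+ n + 1ℤ) * (+ n + 1ℤ))
  ≡⟨ step (+ n) ⟩
    (+ n + 1ℤ) * ((+ n + 1ℤ) + 1ℤ) * (+ 2 * (+ n + 1ℤ) + 1ℤ)
  ≡⟨ cong (λ x → x * (x + 1ℤ) * (+ 2 * x + 1ℤ)) (sym (pos-suc n)) ⟩
    + suc n * (+ suc n + 1ℤ) * (+ 2 * + suc n + 1ℤ) ∎
  where
  open ≡-Reasoning
  step : ∀ x → x * (x + 1ℤ) * (+ 2 * x + 1ℤ) + + 6 * ((x + 1ℤ) * (x + 1ℤ))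
             ≡ (x + 1ℤ) * ((x + 1ℤ) + 1ℤ) * (+ 2 * (x + 1ℤ) + 1ℤ)
  step = solve-∀

pos-∸ : ∀ {s u} → u ≤ s → + (s ∸ u) ≡ + s - + u
pos-∸ {s} {u} u≤s = trans (sym (ℤₚ.⊖-≥ u≤s)) (sym (ℤₚ.[+m]-[+n]≡m⊖n s u))

pos-^1 : ∀ s → + (s ^ 1) ≡ + s
pos-^1 s = cong +_ (ℕₚ.*-identityʳ s)

pos-^2 : ∀ s → + (s ^ 2) ≡ + s * + s
pos-^2 s = trans (cong (λ t → + (s ℕ.* t)) (ℕₚ.*-identityʳ s)) (ℤₚ.pos-* s s)

pos-^3 : ∀ s → + (s ^ 3) ≡ + s * + s * + s
pos-^3 s = trans (cong (λ t → + (s ℕ.* t)) (pos-^2-ℕ s))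
  (trans (ℤₚ.pos-* s (s ℕ.* s)) (trans (cong (+ s *_) (ℤₚ.pos-* s s)) (sym (ℤₚ.*-assoc (+ s) (+ s) (+ s)))))
  where
  pos-^2-ℕ : ∀ s → s ^ 2 ≡ s ℕ.* s
  pos-^2-ℕ s = cong (s ℕ.*_) (ℕₚ.*-identityʳ s)

quadForm : ℕ → ℕ → ℤ
quadForm u v = + u * + u + + u * + v + + v * + v

quadForm-complement : ∀ s u → u ≤ s → quadForm u (s ∸ u) ≡ + s * + s - + s * + u + + u * + u
quadForm-complement s u u≤s = trans (cong (λ t → + u * + u + + u * t + t * t) (pos-∸ u≤s)) (expand (+ s) (+ u))
  where
  expand : ∀ S U → U * U + U * (S - U) + (S - U) * (S - U) ≡ S * S - S * U + U * U
  expand = solve-∀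

boundarySum : ℕ → ℤ
boundarySum s = sumTo s (λ u → 𝟙 (1 ≤? u) * (𝟙 (u <? s) * quadForm u (s ∸ u)))

boundarySum-value : ∀ s → + 6 * boundarySum s ≡ + 5 * + s * + s * + s - + 6 * + s * + s + + s
boundarySum-value zero    = refl
boundarySum-value (suc t) = begin
    + 6 * boundarySum s
  ≡⟨ cong (+ 6 *_) (trans (sum-cong s (λ u u≤s → cong (λ x → 𝟙 (1 ≤? u) * (𝟙 (u <? s) * x)) (quadForm-complement s u u≤s)))
                          (sum-interior t R)) ⟩
    + 6 * (sumTo s R - R 0 - R s)
  ≡⟨ cong (λ x → + 6 * (x - R 0 - R s)) sum-R ⟩
    + 6 * ((S * S * sumTo s (λ _ → 1ℤ) - S * sumTo s (λ u → + u) + sumTo s (λ u → + u * + u)) - R 0 - R s)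
  ≡⟨ faulhaber S _ _ _ (sum-1 s) (sum-id s) (sum-square s) ⟩
    + 5 * S * S * S - + 6 * S * S + S ∎
  where
  open ≡-Reasoning
  s = suc t
  S = + s
  R : ℕ → ℤ
  R u = S * S - S * + u + + u * + u
  sum-R : sumTo s R ≡ S * S * sumTo s (λ _ → 1ℤ) - S * sumTo s (λ u → + u) + sumTo s (λ u → + u * + u)
  sum-R = trans (sum-+ s _ _) (cong (_+ sumTo s (λ u → + u * + u))
            (trans (sum-− s _ _) (cong₂ _-_ (trans (sum-cong s (λ _ _ → sym (ℤₚ.*-identityʳ (S * S)))) (sum-*ˡ s (S * S) _))
                                           (sum-*ˡ s S (λ u → + u)))))
  faulhaber : ∀ S A B C → A ≡ S + 1ℤ → + 2 * B ≡ S * (S + 1ℤ) → + 6 * C ≡ S * (S + 1ℤ) * (+ 2 * S + 1ℤ) →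
    + 6 * ((S * S * A - S * B + C) - (S * S - S * 0ℤ + 0ℤ * 0ℤ) - (S * S - S * S + S * S))
      ≡ + 5 * S * S * S - + 6 * S * S + S
  faulhaber S A B C refl 2B≡ 6C≡ = trans (regroup S B C) (trans (cong₂ (λ x y → + 6 * S * S * (S + 1ℤ) - + 3 * S * x + y - + 12 * S * S) 2B≡ 6C≡) (closed S))
    where
    regroup : ∀ S B C → + 6 * ((S * S * (S + 1ℤ) - S * B + C) - (S * S - S * 0ℤ + 0ℤ * 0ℤ) - (S * S - S * S + S * S))
                        ≡ + 6 * S * S * (S + 1ℤ) - + 3 * S * (+ 2 * B) + + 6 * C - + 12 * S * S
    regroup = solve-∀
    closed : ∀ S → + 6 * S * S * (S + 1ℤ) - + 3 * S * (S * (S + 1ℤ)) + S * (S + 1ℤ) * (+ 2 * S + 1ℤ) - + 12 * S * S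
                   ≡ + 5 * S * S * S - + 6 * S * S + S
    closed = solve-∀

+-sumToℕ : ∀ n f → + sumToℕ n f ≡ sumTo n (λ i → + f i)
+-sumToℕ zero    f = refl
+-sumToℕ (suc n) f = trans (ℤₚ.pos-+ (sumToℕ n f) (f (suc n))) (cong (_+ + f (suc n)) (+-sumToℕ n f))

divisorTerm : ℕ → ℕ → ℕ → ℤ
divisorTerm k zero    n       = 0ℤ
divisorTerm k (suc d) zero    = 0ℤ
divisorTerm k (suc d) (suc n) = 𝟙 (suc d ∣? suc n) * + (suc d ^ k)

-- The left side of σₖ-summand is the summand local to the definition of σₖ, which has
-- no name; the mutual block lets σₖ-divisorTerms fix it by unification.
mutual
  σₖ-divisorTerms : ∀ k n → + σₖ k n ≡ sumTo n (λ d → divisorTerm k d n)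
  σₖ-divisorTerms k zero    = refl
  σₖ-divisorTerms k (suc n) = trans (+-sumToℕ (suc n) _) (sum-cong (suc n) λ d _ → σₖ-summand k n d)

  σₖ-summand : ∀ k n d → _ ≡ divisorTerm k d (suc n)
  σₖ-summand k n zero = refl
  σₖ-summand k n (suc d) with suc d ∣? suc n
  ... | yes _ = sym (ℤₚ.*-identityˡ _)
  ... | no _  = refl

divisorTerm-vanish : ∀ j a k → k < a → divisorTerm j a k ≡ 0ℤ
divisorTerm-vanish j (suc a) zero    _   = refl
divisorTerm-vanish j (suc a) (suc k) k<a = 𝟙*-no (suc a ∣? suc k) (λ a∣k → ℕₚ.<⇒≱ k<a (∣⇒≤ a∣k)) _

σₖ-divisorTerms-upTo : ∀ j k M → k ≤ M → + σₖ j k ≡ sumTo M (λ a → divisorTerm j a k)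
σₖ-divisorTerms-upTo j k M k≤M =
  trans (σₖ-divisorTerms j k) (sym (sum-extend k M _ k≤M (λ a k<a → divisorTerm-vanish j a k k<a)))

σₖ-divisorSum : ∀ j m′ → + σₖ j (suc m′) ≡ sumTo (suc m′) (λ s → 𝟙 (s ∣? suc m′) * + (s ^ j))
σₖ-divisorSum j m′ = trans (σₖ-divisorTerms j (suc m′)) (sum-cong (suc m′) (λ s _ → term s))
  where
  term : ∀ s → divisorTerm j s (suc m′) ≡ 𝟙 (s ∣? suc m′) * + (s ^ j)
  term zero    = sym (𝟙*-no (0 ∣? suc m′) (λ 0∣m → ℕₚ.1+n≢0 (0∣⇒≡0 0∣m)) (+ (0 ^ j)))
  term (suc s) = refl

1≰n*0 : ∀ n → ¬ 1 ≤ n ℕ.* 0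
1≰n*0 n 1≤n*0 = ℕₚ.n≮0 (subst (0 <_) (ℕₚ.*-zeroʳ n) 1≤n*0)

-- The hypotheses are the two decompositions, by trichotomy and by shifting, of the weighted
-- counts N** for the weights uv, u² and v², with <-parts L** and =-parts E**; the >-parts
-- have already been rewritten as <-parts by symmetry.
eliminate : ∀ Luv Luu Lvv Euv Euu Evv F Nuv Nuu Nvv →
  Nuv ≡ Luv + Euv + Luv → Nuu ≡ Luu + Euu + Lvv → Nvv ≡ Lvv + Evv + Luu →
  Nuv ≡ (Luv + Lvv) + F + (Lvv + Luv) →
  Nuu ≡ (Luu + + 2 * Luv + Lvv) + F + Lvv →
  Nvv ≡ Lvv + F + (Lvv + + 2 * Luv + Luu) →
  + 2 * Nuv ≡ (Euu + Euv + Evv) - F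
eliminate Luv Luu Lvv Euv Euu Evv F Nuv Nuu Nvv h₁ h₂ h₃ h₄ h₅ h₆ =
  ℤₚ.i-j≡0⇒i≡j _ _ (trans (combination Luv Luu Lvv Euv Euu Evv F Nuv Nuu Nvv)
    (cong (_+ 0ℤ) (cong₂ _-_ (cong₂ _+_ (cong₂ _-_ (cong₂ _+_ (cong₂ _+_ (zero-diff h₁) (zero-diff h₄)) (zero-diff h₂))
      (zero-diff h₅)) (zero-diff h₃)) (zero-diff h₆))))
  where
  zero-diff : ∀ {a b} → a ≡ b → a - b ≡ 0ℤ
  zero-diff = ℤₚ.i≡j⇒i-j≡0
  combination : ∀ Luv Luu Lvv Euv Euu Evv F Nuv Nuu Nvv →
    + 2 * Nuv - ((Euu + Euv + Evv) - F) ≡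
      (Nuv - (Luv + Euv + Luv)) + (Nuv - ((Luv + Lvv) + F + (Lvv + Luv))) + (Nuu - (Luu + Euu + Lvv))
      - (Nuu - ((Luu + + 2 * Luv + Lvv) + F + Lvv)) + (Nvv - (Lvv + Evv + Luu))
      - (Nvv - (Lvv + F + (Lvv + + 2 * Luv + Luu))) + 0ℤ
  combination = solve-∀

module Besge (m′ : ℕ) where

  m : ℕ
  m = suc m′

  Split : ℕ → ℕ → ℕ → Set
  Split a b k = (1 ≤ a) × (1 ≤ b) × (1 ≤ k) × (k < m) × (a ∣ k) × (b ∣ m ∸ k)

  split? : ∀ a b k → Dec (Split a b k)
  split? a b k = (1 ≤? a) ×-dec (1 ≤? b) ×-dec (1 ≤? k) ×-dec (k <? m) ×-dec (a ∣? k) ×-dec (b ∣? (m ∸ k))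

  N N< N= N> : ℕ → ℕ → ℤ
  N  a b = sumTo m (λ k → 𝟙 (split? a b k))
  N< a b = sumTo m (λ k → 𝟙 (split? a b k ×-dec (b ℕ.* k <? a ℕ.* (m ∸ k))))
  N= a b = sumTo m (λ k → 𝟙 (split? a b k ×-dec (b ℕ.* k ℕ.≟ a ℕ.* (m ∸ k))))
  N> a b = sumTo m (λ k → 𝟙 (split? a b k ×-dec (a ℕ.* (m ∸ k) <? b ℕ.* k)))

  N-trichotomy : ∀ a b → N a b ≡ N< a b + N= a b + N> a b
  N-trichotomy a b = trans (sum-cong m (λ k _ → 𝟙-split₃ (split? a b k) (b ℕ.* k) (a ℕ.* (m ∸ k))))
                     (trans (sum-+ m _ _) (cong (_+ N> a b) (sum-+ m _ _)))

  Split-mirror : ∀ a b k → k ≤ m → Split a b (m ∸ k) → Split b a k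
  Split-mirror a b k k≤m (1≤a , 1≤b , 1≤m-k , m-k<m , a∣m-k , b∣m-[m-k]) =
    1≤b , 1≤a , 1≤k , k<m , subst (b ∣_) (ℕₚ.m∸[m∸n]≡n k≤m) b∣m-[m-k] , a∣m-k
    where
    1≤k : 1 ≤ k
    1≤k = ℕₚ.≰⇒> (λ k≤0 → ℕₚ.<-irrefl (cong (m ∸_) (ℕₚ.n≤0⇒n≡0 k≤0)) m-k<m)
    k<m : k < m
    k<m = ℕₚ.≤∧≢⇒< k≤m (λ k≡m → ℕₚ.<⇒≱ 1≤m-k (ℕₚ.≤-reflexive (trans (cong (m ∸_) k≡m) (ℕₚ.n∸n≡0 m))))

  Split-mirror⁻¹ : ∀ a b k → k ≤ m → Split b a k → Split a b (m ∸ k)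
  Split-mirror⁻¹ a b k k≤m (1≤b , 1≤a , 1≤k , k<m , b∣k , a∣m-k) =
    1≤a , 1≤b , ℕₚ.m<n⇒0<n∸m k<m , ℕₚ.∸-monoʳ-< 1≤k k≤m , a∣m-k , subst (b ∣_) (sym (ℕₚ.m∸[m∸n]≡n k≤m)) b∣k

  N-sym : ∀ a b → N a b ≡ N b a
  N-sym a b = trans (sum-reflect m _) (sum-cong m (λ k k≤m →
    𝟙-⇔ (split? a b (m ∸ k)) (split? b a k) (Split-mirror a b k k≤m) (Split-mirror⁻¹ a b k k≤m)))

  N<≡N> : ∀ a b → N< a b ≡ N> b a
  N<≡N> a b = trans (sum-reflect m _) (sum-cong m (λ k k≤m →
    𝟙-⇔ (split? a b (m ∸ k) ×-dec (b ℕ.* (m ∸ k) <? a ℕ.* (m ∸ (m ∸ k)))) (split? b a k ×-dec (b ℕ.* (m ∸ k) <? a ℕ.* k))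
      (λ { (s , lt) → Split-mirror a b k k≤m s , subst (λ t → b ℕ.* (m ∸ k) < a ℕ.* t) (ℕₚ.m∸[m∸n]≡n k≤m) lt })
      (λ { (s , lt) → Split-mirror⁻¹ a b k k≤m s , subst (λ t → b ℕ.* (m ∸ k) < a ℕ.* t) (sym (ℕₚ.m∸[m∸n]≡n k≤m)) lt })))

  Split⁻ : ℕ → ℕ → ℕ → Set
  Split⁻ a b k = (1 ≤ a) × (1 ≤ b) × (1 ≤ k) × (k < m) × (b ∣ m ∸ k)

  split⁻? : ∀ a b k → Dec (Split⁻ a b k)
  split⁻? a b k = (1 ≤? a) ×-dec (1 ≤? b) ×-dec (1 ≤? k) ×-dec (k <? m) ×-dec (b ∣? (m ∸ k))

  𝟙-split : ∀ a b k → 𝟙 (split? a b k) ≡ 𝟙 (a ∣? k) * 𝟙 (split⁻? a b k)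
  𝟙-split a b k = trans (𝟙-⇔ (split? a b k) ((a ∣? k) ×-dec split⁻? a b k)
      (λ { (p₁ , p₂ , p₃ , p₄ , p₅ , p₆) → p₅ , p₁ , p₂ , p₃ , p₄ , p₆ })
      (λ { (p₅ , p₁ , p₂ , p₃ , p₄ , p₆) → p₁ , p₂ , p₃ , p₄ , p₅ , p₆ }))
    (𝟙-× (a ∣? k) (split⁻? a b k))

  𝟙-split-× : ∀ a b k {Q : Set} (q : Dec Q) → 𝟙 (split? a b k ×-dec q) ≡ 𝟙 (a ∣? k) * 𝟙 (split⁻? a b k ×-dec q)
  𝟙-split-× a b k q = trans (𝟙-⇔ (split? a b k ×-dec q) ((a ∣? k) ×-dec (split⁻? a b k ×-dec q))
      (λ { ((p₁ , p₂ , p₃ , p₄ , p₅ , p₆) , z) → p₅ , (p₁ , p₂ , p₃ , p₄ , p₆) , z })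
      (λ { (p₅ , (p₁ , p₂ , p₃ , p₄ , p₆) , z) → (p₁ , p₂ , p₃ , p₄ , p₅ , p₆) , z }))
    (𝟙-× (a ∣? k) (split⁻? a b k ×-dec q))

  N-multiples : ∀ c b → N (suc c) b ≡ sumTo m (λ x → 𝟙 (suc c ℕ.* x ≤? m) * 𝟙 (split⁻? (suc c) b (suc c ℕ.* x)))
  N-multiples c b = trans (sum-cong m (λ k _ → 𝟙-split (suc c) b k)) (sum-multiples c m _)

  N-multiples-× : ∀ c b {Q : ℕ → Set} (q? : ∀ k → Dec (Q k)) →
    sumTo m (λ k → 𝟙 (split? (suc c) b k ×-dec q? k)) ≡
    sumTo m (λ x → 𝟙 (suc c ℕ.* x ≤? m) * 𝟙 (split⁻? (suc c) b (suc c ℕ.* x) ×-dec q? (suc c ℕ.* x)))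
  N-multiples-× c b q? = trans (sum-cong m (λ k _ → 𝟙-split-× (suc c) b k (q? k))) (sum-multiples c m _)

  ∣⇒≤-pos : ∀ {a k} → a ∣ k → 1 ≤ k → a ≤ k
  ∣⇒≤-pos {a} {suc k} a∣k _ = ∣⇒≤ a∣k

  Split⇒a<m : ∀ {a b k} → Split a b k → a < m
  Split⇒a<m (_ , _ , 1≤k , k<m , a∣k , _) = ℕₚ.≤-<-trans (∣⇒≤-pos a∣k 1≤k) k<m

  Split⇒b≤m : ∀ {a b k} → Split a b k → b ≤ m
  Split⇒b≤m {k = k} (_ , _ , _ , k<m , _ , b∣m-k) = ℕₚ.≤-trans (∣⇒≤-pos b∣m-k (ℕₚ.m<n⇒0<n∸m k<m)) (ℕₚ.m∸n≤m m k)

  N-vanishesˡ : ∀ a b → m < a → N a b ≡ 0ℤ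
  N-vanishesˡ a b m<a = sum-zero m _ (λ k _ → 𝟙-no (split? a b k) (λ s → ℕₚ.<-asym m<a (Split⇒a<m s)))

  N-vanishesʳ : ∀ a b → m < b → N a b ≡ 0ℤ
  N-vanishesʳ a b m<b = sum-zero m _ (λ k _ → 𝟙-no (split? a b k) (λ s → ℕₚ.<⇒≱ m<b (Split⇒b≤m s)))

  N-zeroʳ : ∀ a → N a 0 ≡ 0ℤ
  N-zeroʳ a = sum-zero m _ (λ k _ → 𝟙-no (split? a 0 k) (λ { (_ , () , _) }))

  N<-zeroˡ : ∀ b → N< 0 b ≡ 0ℤ
  N<-zeroˡ b = sum-zero m _ (λ k _ → 𝟙-no (split? 0 b k ×-dec (b ℕ.* k <? 0)) (λ { ((() , _) , _) }))

  N<-zeroʳ : ∀ a → N< a 0 ≡ 0ℤ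
  N<-zeroʳ a = sum-zero m _ (λ k _ → 𝟙-no (split? a 0 k ×-dec (0 <? a ℕ.* (m ∸ k))) (λ { ((_ , () , _) , _) }))

  ∸-summand : ∀ ax ux bx → ax ≡ ux ℕ.+ bx → ax ≤ m → m ∸ ux ≡ (m ∸ ax) ℕ.+ bx
  ∸-summand ax ux bx ax≡ ax≤m = begin
      m ∸ ux
    ≡⟨ cong (_∸ ux) (sym (ℕₚ.m∸n+n≡m ax≤m)) ⟩
      ((m ∸ ax) ℕ.+ ax) ∸ ux
    ≡⟨ cong (λ t → ((m ∸ ax) ℕ.+ t) ∸ ux) ax≡ ⟩
      ((m ∸ ax) ℕ.+ (ux ℕ.+ bx)) ∸ ux
    ≡⟨ cong (_∸ ux) (+-left-comm (m ∸ ax) ux bx) ⟩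
      (ux ℕ.+ ((m ∸ ax) ℕ.+ bx)) ∸ ux
    ≡⟨ ℕₚ.m+n∸m≡n ux _ ⟩
      (m ∸ ax) ℕ.+ bx ∎
    where open ≡-Reasoning

  -- A splitting k = (u+b)x of m for the pair (u+b, b) corresponds to the splitting k = ux
  -- for (u, b) with b·ux < u(m − ux): both say that m − (u+b)x is a positive multiple of b.
  module _ (u′ b′ x′ : ℕ) where
    private
      u b x a ux bx ax : ℕ
      u  = suc u′
      b  = suc b′
      x  = suc x′
      a  = u ℕ.+ b
      ux = u ℕ.* x
      bx = b ℕ.* x
      ax = a ℕ.* x
      ax≡ : ax ≡ ux ℕ.+ bx
      ax≡ = ℕₚ.*-distribʳ-+ x u b

    shift-forward : (ax ≤ m) × Split⁻ a b ax → (ux ≤ m) × (Split⁻ u b ux × (b ℕ.* ux < u ℕ.* (m ∸ ux)))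
    shift-forward (ax≤m , _ , 1≤b , _ , ax<m , b∣m-ax) =
      ux≤m , (s≤s z≤n , 1≤b , s≤s z≤n , ux<m , b∣m-ux) , bux<
      where
      ux≤ax : ux ≤ ax
      ux≤ax = subst (ux ≤_) (sym ax≡) (ℕₚ.m≤m+n ux bx)
      ux≤m = ℕₚ.≤-trans ux≤ax ax≤m
      ux<m = ℕₚ.≤-<-trans ux≤ax ax<m
      m-ux≡ = ∸-summand ax ux bx ax≡ ax≤m
      b∣m-ux : b ∣ m ∸ ux
      b∣m-ux = subst (b ∣_) (sym m-ux≡) (∣m∣n⇒∣m+n b∣m-ax (m∣m*n x))
      bx< : bx < m ∸ ux
      bx< = subst (bx <_) (sym m-ux≡) (ℕₚ.+-monoˡ-≤ bx (ℕₚ.m<n⇒0<n∸m ax<m))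
      bux< : b ℕ.* ux < u ℕ.* (m ∸ ux)
      bux< = subst (_< u ℕ.* (m ∸ ux)) (sym (*-left-comm b u x)) (ℕₚ.*-monoʳ-< u bx<)

    shift-backward : (ux ≤ m) × (Split⁻ u b ux × (b ℕ.* ux < u ℕ.* (m ∸ ux))) → (ax ≤ m) × Split⁻ a b ax
    shift-backward (ux≤m , (_ , 1≤b , _ , _ , b∣m-ux) , bux<) =
      ℕₚ.<⇒≤ ax<m , s≤s z≤n , 1≤b , s≤s z≤n , ax<m , b∣m-ax
      where
      bx< : bx < m ∸ ux
      bx< = ℕₚ.*-cancelˡ-< u bx (m ∸ ux) (subst (_< u ℕ.* (m ∸ ux)) (*-left-comm b u x) bux<)
      ax<m : ax < m
      ax<m = subst (_< m) (sym ax≡) (subst (ux ℕ.+ bx <_) (ℕₚ.m+[n∸m]≡n ux≤m) (ℕₚ.+-monoʳ-< ux bx<))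
      b∣m-ax : b ∣ m ∸ ax
      b∣m-ax = ∣m+n∣m⇒∣n (subst (b ∣_) (trans (∸-summand ax ux bx ax≡ (ℕₚ.<⇒≤ ax<m)) (ℕₚ.+-comm (m ∸ ax) bx)) b∣m-ux) (m∣m*n x)

    shift-point : 𝟙 (ax ≤? m) * 𝟙 (split⁻? a b ax) ≡ 𝟙 (ux ≤? m) * 𝟙 (split⁻? u b ux ×-dec (b ℕ.* ux <? u ℕ.* (m ∸ ux)))
    shift-point = trans (sym (𝟙-× (ax ≤? m) (split⁻? a b ax)))
                        (trans (𝟙-⇔ _ _ shift-forward shift-backward) (𝟙-× (ux ≤? m) _))

  shift-term : ∀ u′ b′ x → let u = suc u′ ; b = suc b′ ; a = u ℕ.+ b in
    𝟙 (a ℕ.* x ≤? m) * 𝟙 (split⁻? a b (a ℕ.* x)) ≡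
    𝟙 (u ℕ.* x ≤? m) * 𝟙 (split⁻? u b (u ℕ.* x) ×-dec (b ℕ.* (u ℕ.* x) <? u ℕ.* (m ∸ u ℕ.* x)))
  shift-term u′ b′ zero = trans (cong (𝟙 (a ℕ.* 0 ≤? m) *_) (𝟙-no (split⁻? a b (a ℕ.* 0)) (1≰n*0 a ∘ proj₁ ∘ proj₂ ∘ proj₂)))
    (trans (ℤₚ.*-zeroʳ (𝟙 (a ℕ.* 0 ≤? m))) (sym (trans (cong (𝟙 (u ℕ.* 0 ≤? m) *_) (𝟙-no (split⁻? u b (u ℕ.* 0) ×-dec _) (1≰n*0 u ∘ proj₁ ∘ proj₂ ∘ proj₂ ∘ proj₁)))
                                      (ℤₚ.*-zeroʳ (𝟙 (u ℕ.* 0 ≤? m))))))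
    where
    u = suc u′ ; b = suc b′ ; a = u ℕ.+ b
  shift-term u′ b′ (suc x′) = shift-point u′ b′ x′

  N-shiftˡ : ∀ u b → 𝟙 (1 ≤? u) * N (u ℕ.+ b) b ≡ N< u b
  N-shiftˡ zero     b        = trans (ℤₚ.*-zeroˡ (N b b)) (sym (N<-zeroˡ b))
  N-shiftˡ (suc u′) zero     = trans (ℤₚ.*-identityˡ _) (trans (N-zeroʳ (suc u′ ℕ.+ 0)) (sym (N<-zeroʳ (suc u′))))
  N-shiftˡ (suc u′) (suc b′) = trans (ℤₚ.*-identityˡ _) (trans (N-multiples (u′ ℕ.+ suc b′) (suc b′))
    (trans (sum-cong m (λ x _ → shift-term u′ b′ x)) (sym (N-multiples-× u′ (suc b′) (λ k → suc b′ ℕ.* k <? suc u′ ℕ.* (m ∸ k))))))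

  N-shiftʳ : ∀ a v → 𝟙 (1 ≤? v) * N a (a ℕ.+ v) ≡ N> a v
  N-shiftʳ a v = trans (cong (𝟙 (1 ≤? v) *_) (trans (N-sym a (a ℕ.+ v)) (cong (λ t → N t a) (ℕₚ.+-comm a v))))
                   (trans (N-shiftˡ v a) (N<≡N> v a))

  ΣΣ : (ℕ → ℕ → ℤ) → ℤ
  ΣΣ F = sumTo m (λ a → sumTo m (λ b → F a b))

  ΣΣ-cong : ∀ {F G : ℕ → ℕ → ℤ} → (∀ a b → F a b ≡ G a b) → ΣΣ F ≡ ΣΣ G
  ΣΣ-cong F≗G = sum-cong m (λ a _ → sum-cong m (λ b _ → F≗G a b))

  ΣΣ-+ : ∀ (F G : ℕ → ℕ → ℤ) → ΣΣ (λ a b → F a b + G a b) ≡ ΣΣ F + ΣΣ G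
  ΣΣ-+ F G = trans (sum-cong m (λ a _ → sum-+ m (F a) (G a))) (sum-+ m _ _)

  ΣΣ-*ˡ : ∀ c (F : ℕ → ℕ → ℤ) → ΣΣ (λ a b → c * F a b) ≡ c * ΣΣ F
  ΣΣ-*ˡ c F = trans (sum-cong m (λ a _ → sum-*ˡ m c (F a))) (sum-*ˡ m c _)

  ΣΣ-swap : ∀ (F : ℕ → ℕ → ℤ) → ΣΣ F ≡ ΣΣ (λ a b → F b a)
  ΣΣ-swap F = sum-swap m m F

  weighted-N-split : ∀ (g : ℕ → ℕ → ℤ) →
    ΣΣ (λ a b → g a b * N a b) ≡
      ΣΣ (λ u v → g (u ℕ.+ v) v * N< u v) + sumTo m (λ a → g a a * N a a) + ΣΣ (λ u v → g u (u ℕ.+ v) * N> u v)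
  weighted-N-split g =
    trans (ΣΣ-cong (λ a b → trans (sym (ℤₚ.*-identityˡ (G a b)))
                                  (trans (cong (_* G a b) (sym (𝟙-trichotomy b a))) (distrib₃ (𝟙 (b <? a)) (𝟙 (b ℕ.≟ a)) (𝟙 (a <? b)) (G a b)))))
          (trans (ΣΣ-+ _ _) (cong₂ _+_ (trans (ΣΣ-+ _ _) (cong₂ _+_ below diagonal)) above))
    where
    G : ℕ → ℕ → ℤ
    G a b = g a b * N a b
    distrib₃ : ∀ x y z g → (x + y + z) * g ≡ x * g + y * g + z * g
    distrib₃ = solve-∀
    swap-front : ∀ x y z → x * (y * z) ≡ y * (x * z)
    swap-front = solve-∀
    below : ΣΣ (λ a b → 𝟙 (b <? a) * G a b) ≡ ΣΣ (λ u v → g (u ℕ.+ v) v * N< u v)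
    below = trans (ΣΣ-swap _)
      (trans (sum-cong m (λ b _ → sum-shift m b (λ a → G a b) (λ a m<a → trans (cong (g a b *_) (N-vanishesˡ a b m<a)) (ℤₚ.*-zeroʳ (g a b)))))
      (trans (sum-cong m (λ b _ → sum-cong m (λ u _ →
               trans (swap-front (𝟙 (1 ≤? u)) (g (b ℕ.+ u) b) _)
               (trans (cong₂ (λ s t → g s b * (𝟙 (1 ≤? u) * N t b)) (ℕₚ.+-comm b u) (ℕₚ.+-comm b u))
                 (cong (g (u ℕ.+ b) b *_) (N-shiftˡ u b))))))
      (sym (ΣΣ-swap _))))
    diagonal : ΣΣ (λ a b → 𝟙 (b ℕ.≟ a) * G a b) ≡ sumTo m (λ a → g a a * N a a)
    diagonal = sum-cong m (λ a a≤m → sum-𝟙≟ m a (G a) a≤m)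
    above : ΣΣ (λ a b → 𝟙 (a <? b) * G a b) ≡ ΣΣ (λ u v → g u (u ℕ.+ v) * N> u v)
    above = sum-cong m (λ a _ → trans (sum-shift m a (G a) (λ b m<b → trans (cong (g a b *_) (N-vanishesʳ a b m<b)) (ℤₚ.*-zeroʳ (g a b))))
              (sum-cong m (λ v _ → trans (swap-front (𝟙 (1 ≤? v)) (g a (a ℕ.+ v)) _) (cong (g a (a ℕ.+ v) *_) (N-shiftʳ a v)))))

  weighted : (ℕ → ℕ → ℤ) → (ℕ → ℕ → ℤ) → ℤ
  weighted w X = ΣΣ (λ u v → w u v * X u v)

  uv uu vv : ℕ → ℕ → ℤ
  uv u v = + u * + v
  uu u v = + u * + u
  vv u v = + v * + v

  diagonalSum : ℤ
  diagonalSum = sumTo m (λ a → + a * + a * N a a)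

  weighted-trichotomy : ∀ w → weighted w N ≡ weighted w N< + weighted w N= + weighted w N>
  weighted-trichotomy w =
    trans (ΣΣ-cong (λ u v → trans (cong (w u v *_) (N-trichotomy u v)) (distrib₃ (w u v) (N< u v) (N= u v) (N> u v))))
          (trans (ΣΣ-+ _ _) (cong (_+ weighted w N>) (ΣΣ-+ _ _)))
    where
    distrib₃ : ∀ w a b c → w * (a + b + c) ≡ w * a + w * b + w * c
    distrib₃ = solve-∀

  weighted-N> : ∀ w → weighted w N> ≡ weighted (λ u v → w v u) N<
  weighted-N> w = trans (ΣΣ-cong (λ u v → cong (w u v *_) (sym (N<≡N> v u)))) (ΣΣ-swap _)

  weighted-shift-uv : weighted uv N ≡ (weighted uv N< + weighted vv N<) + diagonalSum + (weighted uu N> + weighted uv N>)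
  weighted-shift-uv = trans (weighted-N-split uv) (cong₂ _+_ (cong (_+ diagonalSum)
      (trans (ΣΣ-cong (λ u v → trans (cong (λ t → t * + v * N< u v) (ℤₚ.pos-+ u v)) (expand (+ u) (+ v) (N< u v)))) (ΣΣ-+ _ _)))
      (trans (ΣΣ-cong (λ u v → trans (cong (λ t → + u * t * N> u v) (ℤₚ.pos-+ u v)) (expand′ (+ u) (+ v) (N> u v)))) (ΣΣ-+ _ _)))
    where
    expand : ∀ x y n → (x + y) * y * n ≡ x * y * n + y * y * n
    expand = solve-∀
    expand′ : ∀ x y n → x * (x + y) * n ≡ x * x * n + x * y * n
    expand′ = solve-∀

  square-+ : ∀ x y n → (x + y) * (x + y) * n ≡ x * x * n + + 2 * (x * y * n) + y * y * n
  square-+ = solve-∀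

  weighted-shift-uu : weighted uu N ≡ (weighted uu N< + + 2 * weighted uv N< + weighted vv N<) + diagonalSum + weighted uu N>
  weighted-shift-uu = trans (weighted-N-split uu) (cong (λ t → t + diagonalSum + weighted uu N>)
      (trans (ΣΣ-cong (λ u v → trans (cong (λ t → t * t * N< u v) (ℤₚ.pos-+ u v)) (square-+ (+ u) (+ v) (N< u v))))
        (trans (ΣΣ-+ _ _) (cong (_+ weighted vv N<) (trans (ΣΣ-+ _ _) (cong (λ t → weighted uu N< + t) (ΣΣ-*ˡ (+ 2) _)))))))

  weighted-shift-vv : weighted vv N ≡ weighted vv N< + diagonalSum + (weighted uu N> + + 2 * weighted uv N> + weighted vv N>)
  weighted-shift-vv = trans (weighted-N-split vv) (cong (λ t → weighted vv N< + diagonalSum + t)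
      (trans (ΣΣ-cong (λ u v → trans (cong (λ t → t * t * N> u v) (ℤₚ.pos-+ u v)) (square-+ (+ u) (+ v) (N> u v))))
        (trans (ΣΣ-+ _ _) (cong (_+ weighted vv N>) (trans (ΣΣ-+ _ _) (cong (λ t → weighted uu N> + t) (ΣΣ-*ˡ (+ 2) _)))))))

  weighted-uv-N : + 2 * weighted uv N ≡ (weighted uu N= + weighted uv N= + weighted vv N=) - diagonalSum
  weighted-uv-N = eliminate (weighted uv N<) (weighted uu N<) (weighted vv N<) (weighted uv N=) (weighted uu N=) (weighted vv N=)
      diagonalSum (weighted uv N) (weighted uu N) (weighted vv N)
      (trans (weighted-trichotomy uv) (cong (λ t → weighted uv N< + weighted uv N= + t) uv>))
      (trans (weighted-trichotomy uu) (cong (λ t → weighted uu N< + weighted uu N= + t) uu>))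
      (trans (weighted-trichotomy vv) (cong (λ t → weighted vv N< + weighted vv N= + t) vv>))
      (trans weighted-shift-uv (cong (λ t → (weighted uv N< + weighted vv N<) + diagonalSum + t) (cong₂ _+_ uu> uv>)))
      (trans weighted-shift-uu (cong (λ t → (weighted uu N< + + 2 * weighted uv N< + weighted vv N<) + diagonalSum + t) uu>))
      (trans weighted-shift-vv (cong (λ t → weighted vv N< + diagonalSum + t) (cong₂ _+_ (cong₂ _+_ uu> (cong (+ 2 *_) uv>)) vv>)))
    where
    uv> : weighted uv N> ≡ weighted uv N<
    uv> = trans (weighted-N> uv) (ΣΣ-cong (λ u v → cong (_* N< u v) (ℤₚ.*-comm (+ v) (+ u))))
    uu> : weighted uu N> ≡ weighted vv N<
    uu> = weighted-N> uu
    vv> : weighted vv N> ≡ weighted uu N<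
    vv> = weighted-N> vv

  σ-convolution : ℤ
  σ-convolution = sumTo m (λ k → + σ k * + σ (m ∸ k))

  divisorTerm-product : ∀ a b k r → r ≡ m ∸ k → divisorTerm 1 a k * divisorTerm 1 b r ≡ + a * + b * 𝟙 (split? a b k)
  divisorTerm-product zero b k r _ = refl
  divisorTerm-product (suc a) zero k r _ = trans (ℤₚ.*-zeroʳ (divisorTerm 1 (suc a) k)) (sym (ℤₚ.*-zeroʳ (+ suc a * 0ℤ)))
  divisorTerm-product (suc a) (suc b) zero r _ =
    sym (trans (cong (+ suc a * + suc b *_) (𝟙-no (split? (suc a) (suc b) 0) (λ { (_ , _ , () , _) }))) (ℤₚ.*-zeroʳ (+ suc a * + suc b)))
  divisorTerm-product (suc a) (suc b) (suc k) zero r≡ = trans (ℤₚ.*-zeroʳ (divisorTerm 1 (suc a) (suc k)))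
    (sym (trans (cong (+ suc a * + suc b *_) (𝟙-no (split? (suc a) (suc b) (suc k)) (λ s → ℕₚ.<⇒≢ (ℕₚ.m<n⇒0<n∸m (proj₁ (proj₂ (proj₂ (proj₂ s))))) r≡)))
               (ℤₚ.*-zeroʳ (+ suc a * + suc b))))
  divisorTerm-product (suc a) (suc b) (suc k) (suc r) r≡ = begin
      (𝟙 (suc a ∣? suc k) * + (suc a ^ 1)) * (𝟙 (suc b ∣? suc r) * + (suc b ^ 1))
    ≡⟨ cong₂ (λ s t → (𝟙 (suc a ∣? suc k) * s) * (𝟙 (suc b ∣? suc r) * t)) (pos-^1 (suc a)) (pos-^1 (suc b)) ⟩
      (𝟙 (suc a ∣? suc k) * + suc a) * (𝟙 (suc b ∣? suc r) * + suc b)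
    ≡⟨ regroup (𝟙 (suc a ∣? suc k)) (+ suc a) (𝟙 (suc b ∣? suc r)) (+ suc b) ⟩
      + suc a * + suc b * (𝟙 (suc a ∣? suc k) * 𝟙 (suc b ∣? suc r))
    ≡⟨ cong (+ suc a * + suc b *_) (sym (𝟙-× (suc a ∣? suc k) (suc b ∣? suc r))) ⟩
      + suc a * + suc b * 𝟙 ((suc a ∣? suc k) ×-dec (suc b ∣? suc r))
    ≡⟨ cong (+ suc a * + suc b *_) (𝟙-⇔ _ (split? (suc a) (suc b) (suc k))
         (λ { (a∣k , b∣r) → s≤s z≤n , s≤s z≤n , s≤s z≤n , k<m , a∣k , subst (suc b ∣_) r≡ b∣r })
         (λ { (_ , _ , _ , _ , a∣k , b∣m-k) → a∣k , subst (suc b ∣_) (sym r≡) b∣m-k })) ⟩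
      + suc a * + suc b * 𝟙 (split? (suc a) (suc b) (suc k)) ∎
    where
    open ≡-Reasoning
    regroup : ∀ x y z w → (x * y) * (z * w) ≡ y * w * (x * z)
    regroup = solve-∀
    k<m : suc k < m
    k<m = ℕₚ.m∸n≢0⇒n<m (λ m-k≡0 → ℕₚ.1+n≢0 (trans r≡ m-k≡0))

  σ-convolution≡weighted : σ-convolution ≡ weighted uv N
  σ-convolution≡weighted = begin
      sumTo m (λ k → + σ k * + σ (m ∸ k))
    ≡⟨ sum-cong m (λ k k≤m → cong₂ _*_ (σₖ-divisorTerms-upTo 1 k m k≤m) (σₖ-divisorTerms-upTo 1 (m ∸ k) m (ℕₚ.m∸n≤m m k))) ⟩
      sumTo m (λ k → sumTo m (λ a → divisorTerm 1 a k) * sumTo m (λ b → divisorTerm 1 b (m ∸ k)))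
    ≡⟨ sum-cong m (λ k _ → trans (sym (sum-*ʳ m (λ a → divisorTerm 1 a k) _))
                                 (sum-cong m (λ a _ → sym (sum-*ˡ m (divisorTerm 1 a k) _)))) ⟩
      sumTo m (λ k → sumTo m (λ a → sumTo m (λ b → divisorTerm 1 a k * divisorTerm 1 b (m ∸ k))))
    ≡⟨ sum-cong m (λ k _ → sum-cong m (λ a _ → sum-cong m (λ b _ → divisorTerm-product a b k (m ∸ k) refl))) ⟩
      sumTo m (λ k → sumTo m (λ a → sumTo m (λ b → + a * + b * 𝟙 (split? a b k))))
    ≡⟨ trans (sum-swap m m _) (sum-cong m (λ a _ → sum-swap m m _)) ⟩
      sumTo m (λ a → sumTo m (λ b → sumTo m (λ k → + a * + b * 𝟙 (split? a b k))))
    ≡⟨ ΣΣ-cong (λ a b → sum-*ˡ m (+ a * + b) _) ⟩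
      weighted uv N ∎
    where open ≡-Reasoning

  N-diagonal : ∀ a → + a * N a a ≡ 𝟙 (a ∣? m) * (+ m - + a)
  N-diagonal zero = sym (𝟙*-no (0 ∣? m) (ℕₚ.1+n≢0 ∘ 0∣⇒≡0) (+ m - + 0))
  N-diagonal (suc c) = diagonal (suc c ∣? m)
    where
    a = suc c
    diagonal : (d : Dec (a ∣ m)) → + a * N a a ≡ 𝟙 d * (+ m - + a)
    diagonal (no a∤m) = trans (cong (+ a *_) (trans (N-multiples c a) (sum-zero m _ (λ x _ → vanish x)))) (ℤₚ.*-zeroʳ (+ a))
      where
      vanish : ∀ x → 𝟙 (a ℕ.* x ≤? m) * 𝟙 (split⁻? a a (a ℕ.* x)) ≡ 0ℤ
      vanish x = trans (cong (𝟙 (a ℕ.* x ≤? m) *_) (𝟙-no (split⁻? a a (a ℕ.* x))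
                         (λ { (_ , _ , _ , ax<m , a∣m-ax) → a∤m (∣m∸n∣n⇒∣m a (ℕₚ.<⇒≤ ax<m) a∣m-ax (m∣m*n x)) })))
                       (ℤₚ.*-zeroʳ (𝟙 (a ℕ.* x ≤? m)))
    diagonal (yes (divides zero m≡0)) = ⊥-elim (ℕₚ.1+n≢0 m≡0)
    diagonal (yes (divides (suc q′) m≡qa)) =
      trans (cong (+ a *_) (trans (N-multiples c a) (trans (sum-cong m (λ x _ → term x)) (sum-𝟙-interval m q′))))
            (trans (cong (λ t → + a * + t) (ℕₚ.m≥n⇒m⊓n≡n q′≤m)) (trans closed (sym (ℤₚ.*-identityˡ _))))
      where
      q = suc q′
      q′≤m : q′ ≤ m
      q′≤m = ℕₚ.≤-trans (ℕₚ.n≤1+n q′) (ℕₚ.≤-trans (ℕₚ.m≤m*n q a) (ℕₚ.≤-reflexive (sym m≡qa)))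
      closed : + a * + q′ ≡ + m - + a
      closed = trans (add-sub (+ a) (+ q′))
        (cong (_- + a) (trans (cong (λ t → + a + t) (sym (ℤₚ.pos-* q′ a))) (trans (sym (ℤₚ.pos-+ a (q′ ℕ.* a))) (cong +_ (sym m≡qa)))))
        where
        add-sub : ∀ x y → x * y ≡ (x + y * x) - x
        add-sub = solve-∀
      ax<m⇒x<q : ∀ x → a ℕ.* x < m → x < q
      ax<m⇒x<q x ax<m = ℕₚ.*-cancelʳ-< a x q (subst (_< q ℕ.* a) (ℕₚ.*-comm a x) (subst (a ℕ.* x <_) m≡qa ax<m))
      term : ∀ x → 𝟙 (a ℕ.* x ≤? m) * 𝟙 (split⁻? a a (a ℕ.* x)) ≡ 𝟙 (1 ≤? x ×-dec x ≤? q′)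
      term zero = trans (cong (𝟙 (a ℕ.* 0 ≤? m) *_) (𝟙-no (split⁻? a a (a ℕ.* 0)) (1≰n*0 a ∘ proj₁ ∘ proj₂ ∘ proj₂)))
                        (ℤₚ.*-zeroʳ (𝟙 (a ℕ.* 0 ≤? m)))
      term (suc x′) = trans (sym (𝟙-× (a ℕ.* x ≤? m) (split⁻? a a (a ℕ.* x)))) (𝟙-⇔ _ _ to from)
        where
        x = suc x′
        to : (a ℕ.* x ≤ m) × Split⁻ a a (a ℕ.* x) → (1 ≤ x) × (x ≤ q′)
        to (_ , _ , _ , _ , ax<m , _) = s≤s z≤n , ℕₚ.≤-pred (ax<m⇒x<q x ax<m)
        from : (1 ≤ x) × (x ≤ q′) → (a ℕ.* x ≤ m) × Split⁻ a a (a ℕ.* x)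
        from (_ , x≤q′) = ℕₚ.<⇒≤ ax<m , s≤s z≤n , s≤s z≤n , s≤s z≤n , ax<m , a∣m-ax
          where
          ax<m : a ℕ.* x < m
          ax<m = subst (a ℕ.* x <_) (sym m≡qa) (subst (_< q ℕ.* a) (ℕₚ.*-comm x a) (ℕₚ.*-monoˡ-< a (s≤s x≤q′)))
          a∣m-ax : a ∣ m ∸ a ℕ.* x
          a∣m-ax = divides (q ∸ x) (trans (cong₂ _∸_ m≡qa (ℕₚ.*-comm a x)) (sym (ℕₚ.*-distribʳ-∸ a q x)))

  N=-value : ∀ u v → N= u v ≡ 𝟙 (1 ≤? u) * (𝟙 (1 ≤? v) * 𝟙 ((u ℕ.+ v) ∣? m))
  N=-value zero v =
    sum-zero m _ (λ k _ → 𝟙-no (split? 0 v k ×-dec (v ℕ.* k ℕ.≟ 0 ℕ.* (m ∸ k))) (λ { ((() , _) , _) }))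
  N=-value (suc u′) zero =
    trans (sum-zero m _ (λ k _ → 𝟙-no (split? (suc u′) 0 k ×-dec (0 ℕ.* k ℕ.≟ suc u′ ℕ.* (m ∸ k))) (λ { ((_ , () , _) , _) })))
          (sym (ℤₚ.*-identityˡ (0ℤ * 𝟙 ((suc u′ ℕ.+ 0) ∣? m))))
  N=-value (suc u′) (suc v′) =
    trans (N-multiples-× u′ v (λ k → v ℕ.* k ℕ.≟ u ℕ.* (m ∸ k)))
          (trans (count ((u ℕ.+ v) ∣? m)) (sym (trans (ℤₚ.*-identityˡ _) (ℤₚ.*-identityˡ _))))
    where
    u = suc u′ ; v = suc v′
    T : ℕ → ℤ
    T x = 𝟙 (u ℕ.* x ≤? m) * 𝟙 (split⁻? u v (u ℕ.* x) ×-dec (v ℕ.* (u ℕ.* x) ℕ.≟ u ℕ.* (m ∸ u ℕ.* x)))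
    on-boundary : ∀ x → u ℕ.* x ≤ m → v ℕ.* (u ℕ.* x) ≡ u ℕ.* (m ∸ u ℕ.* x) → m ≡ x ℕ.* (u ℕ.+ v)
    on-boundary x ux≤m vux≡ = begin
        m
      ≡⟨ sym (ℕₚ.m+[n∸m]≡n ux≤m) ⟩
        u ℕ.* x ℕ.+ (m ∸ u ℕ.* x)
      ≡⟨ cong (u ℕ.* x ℕ.+_) (sym (ℕₚ.*-cancelˡ-≡ (v ℕ.* x) (m ∸ u ℕ.* x) u (trans (sym (*-left-comm v u x)) vux≡))) ⟩
        u ℕ.* x ℕ.+ v ℕ.* x
      ≡⟨ sym (ℕₚ.*-distribʳ-+ x u v) ⟩
        (u ℕ.+ v) ℕ.* x
      ≡⟨ ℕₚ.*-comm (u ℕ.+ v) x ⟩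
        x ℕ.* (u ℕ.+ v) ∎
      where open ≡-Reasoning
    count : (D : Dec ((u ℕ.+ v) ∣ m)) → sumTo m T ≡ 𝟙 D
    count (no u+v∤m) = sum-zero m T (λ x _ → trans (sym (𝟙-× (u ℕ.* x ≤? m) _))
      (𝟙-no _ (λ { (ux≤m , _ , vux≡) → u+v∤m (divides x (on-boundary x ux≤m vux≡)) })))
    count (yes (divides zero m≡0)) = ⊥-elim (ℕₚ.1+n≢0 m≡0)
    count (yes (divides (suc q′) m≡q[u+v])) =
      trans (sum-single m q T q≤m (λ x _ x≢q → trans (sym (𝟙-× (u ℕ.* x ≤? m) _))
              (𝟙-no _ (λ { (ux≤m , _ , vux≡) → x≢q (ℕₚ.*-cancelʳ-≡ x q (u ℕ.+ v) (trans (sym (on-boundary x ux≤m vux≡)) m≡q[u+v])) }))))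
            (trans (sym (𝟙-× (u ℕ.* q ≤? m) _)) (𝟙-yes _ hit))
      where
      q = suc q′
      m≡uq+vq : m ≡ u ℕ.* q ℕ.+ v ℕ.* q
      m≡uq+vq = trans m≡q[u+v] (trans (ℕₚ.*-distribˡ-+ q u v) (cong₂ ℕ._+_ (ℕₚ.*-comm q u) (ℕₚ.*-comm q v)))
      m-uq≡vq : m ∸ u ℕ.* q ≡ v ℕ.* q
      m-uq≡vq = trans (cong (_∸ u ℕ.* q) m≡uq+vq) (ℕₚ.m+n∸m≡n (u ℕ.* q) (v ℕ.* q))
      q≤m : q ≤ m
      q≤m = ℕₚ.≤-trans (ℕₚ.m≤m*n q (u ℕ.+ v)) (ℕₚ.≤-reflexive (sym m≡q[u+v]))
      uq<m : u ℕ.* q < m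
      uq<m = subst (u ℕ.* q <_) (sym m≡uq+vq) (ℕₚ.m<m+n (u ℕ.* q) (s≤s z≤n))
      hit : (u ℕ.* q ≤ m) × (Split⁻ u v (u ℕ.* q) × (v ℕ.* (u ℕ.* q) ≡ u ℕ.* (m ∸ u ℕ.* q)))
      hit = ℕₚ.<⇒≤ uq<m , (s≤s z≤n , s≤s z≤n , s≤s z≤n , uq<m , subst (v ∣_) (sym m-uq≡vq) (m∣m*n q)) ,
            trans (*-left-comm v u q) (cong (u ℕ.*_) (sym m-uq≡vq))

  boundaryTotal : ℤ
  boundaryTotal = weighted uu N= + weighted uv N= + weighted vv N=

  boundaryTotal-divisorSum : boundaryTotal ≡ sumTo m (λ s → 𝟙 (s ∣? m) * boundarySum s)
  boundaryTotal-divisorSum = begin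
      weighted uu N= + weighted uv N= + weighted vv N=
    ≡⟨ sym (trans (ΣΣ-+ _ _) (cong (_+ weighted vv N=) (ΣΣ-+ _ _))) ⟩
      ΣΣ (λ u v → uu u v * N= u v + uv u v * N= u v + vv u v * N= u v)
    ≡⟨ ΣΣ-cong (λ u v → trans (collect (uu u v) (uv u v) (vv u v) (N= u v)) (cong (quadForm u v *_) (N=-value u v))) ⟩
      ΣΣ (λ u v → quadForm u v * (𝟙 (1 ≤? u) * (𝟙 (1 ≤? v) * 𝟙 ((u ℕ.+ v) ∣? m))))
    ≡⟨ ΣΣ-cong (λ u v → trans (reorder (quadForm u v) (𝟙 (1 ≤? u)) (𝟙 (1 ≤? v)) (𝟙 ((u ℕ.+ v) ∣? m)))
                        (cong (λ t → 𝟙 (1 ≤? u) * (𝟙 (1 ≤? v) * (𝟙 ((u ℕ.+ v) ∣? m) * quadForm u t))) (sym (ℕₚ.m+n∸m≡n u v)))) ⟩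
      sumTo m (λ u → sumTo m (λ v → 𝟙 (1 ≤? u) * (𝟙 (1 ≤? v) * H u (u ℕ.+ v))))
    ≡⟨ sum-cong m (λ u _ → trans (sum-*ˡ m (𝟙 (1 ≤? u)) _) (cong (𝟙 (1 ≤? u) *_)
          (sym (sum-shift m u (H u) (λ s m<s → 𝟙*-no (s ∣? m) (λ s∣m → ℕₚ.<⇒≱ m<s (∣⇒≤ s∣m)) _))))) ⟩
      sumTo m (λ u → 𝟙 (1 ≤? u) * sumTo m (λ s → 𝟙 (u <? s) * H u s))
    ≡⟨ trans (sum-cong m (λ u _ → sym (sum-*ˡ m (𝟙 (1 ≤? u)) _))) (sum-swap m m _) ⟩
      sumTo m (λ s → sumTo m (λ u → 𝟙 (1 ≤? u) * (𝟙 (u <? s) * H u s)))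
    ≡⟨ sum-cong m (λ s s≤m → trans (sum-cong m (λ u _ → reorder′ (𝟙 (1 ≤? u)) (𝟙 (u <? s)) (𝟙 (s ∣? m)) (quadForm u (s ∸ u))))
                                   (trans (sum-*ˡ m (𝟙 (s ∣? m)) _) (cong (𝟙 (s ∣? m) *_) (truncate s s≤m)))) ⟩
      sumTo m (λ s → 𝟙 (s ∣? m) * boundarySum s) ∎
    where
    open ≡-Reasoning
    H : ℕ → ℕ → ℤ
    H u s = 𝟙 (s ∣? m) * quadForm u (s ∸ u)
    collect : ∀ a b c n → a * n + b * n + c * n ≡ (a + b + c) * n
    collect = solve-∀
    reorder : ∀ x a b c → x * (a * (b * c)) ≡ a * (b * (c * x))
    reorder = solve-∀
    reorder′ : ∀ a b c q → a * (b * (c * q)) ≡ c * (a * (b * q))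
    reorder′ = solve-∀
    truncate : ∀ s → s ≤ m → sumTo m (λ u → 𝟙 (1 ≤? u) * (𝟙 (u <? s) * quadForm u (s ∸ u))) ≡ boundarySum s
    truncate s s≤m = sum-extend s m _ s≤m (λ u s<u →
      trans (cong (𝟙 (1 ≤? u) *_) (𝟙*-no (u <? s) (ℕₚ.<-asym s<u) _)) (ℤₚ.*-zeroʳ (𝟙 (1 ≤? u))))

  boundaryTotal-value : + 6 * boundaryTotal ≡ + 5 * + σₖ 3 m - + 6 * + σₖ 2 m + + σₖ 1 m
  boundaryTotal-value = begin
      + 6 * boundaryTotal
    ≡⟨ trans (cong (+ 6 *_) boundaryTotal-divisorSum) (sym (sum-*ˡ m (+ 6) _)) ⟩
      sumTo m (λ s → + 6 * (𝟙 (s ∣? m) * boundarySum s))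
    ≡⟨ sum-cong m (λ s _ → trans (swap-front (+ 6) (𝟙 (s ∣? m)) (boundarySum s))
                                 (trans (cong (𝟙 (s ∣? m) *_) (boundarySum-value s)) (spread (𝟙 (s ∣? m)) s))) ⟩
      sumTo m (λ s → + 5 * (𝟙 (s ∣? m) * + (s ^ 3)) + - + 6 * (𝟙 (s ∣? m) * + (s ^ 2)) + 𝟙 (s ∣? m) * + (s ^ 1))
    ≡⟨ trans (sum-+ m _ _) (cong₂ _+_ (trans (sum-+ m _ _) (cong₂ _+_ (trans (sum-*ˡ m (+ 5) _) (cong (+ 5 *_) (sym (σₖ-divisorSum 3 m′))))
                                                               (trans (sum-*ˡ m (- + 6) _) (cong (- + 6 *_) (sym (σₖ-divisorSum 2 m′))))))
                                     (sym (σₖ-divisorSum 1 m′))) ⟩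
      + 5 * + σₖ 3 m + - + 6 * + σₖ 2 m + + σₖ 1 m
    ≡⟨ cong (λ t → + 5 * + σₖ 3 m + t + + σₖ 1 m) (sym (ℤₚ.neg-distribˡ-* (+ 6) (+ σₖ 2 m))) ⟩
      + 5 * + σₖ 3 m - + 6 * + σₖ 2 m + + σₖ 1 m ∎
    where
    open ≡-Reasoning
    swap-front : ∀ a b c → a * (b * c) ≡ b * (a * c)
    swap-front = solve-∀
    spread : ∀ e s → e * (+ 5 * + s * + s * + s - + 6 * + s * + s + + s)
                     ≡ + 5 * (e * + (s ^ 3)) + - + 6 * (e * + (s ^ 2)) + e * + (s ^ 1)
    spread e s = trans (distribute e (+ s))
      (cong₂ _+_ (cong₂ _+_ (cong (λ t → + 5 * (e * t)) (sym (pos-^3 s))) (cong (λ t → - + 6 * (e * t)) (sym (pos-^2 s))))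
                 (cong (e *_) (sym (pos-^1 s))))
      where
      distribute : ∀ e s → e * (+ 5 * s * s * s - + 6 * s * s + s) ≡ + 5 * (e * (s * s * s)) + - + 6 * (e * (s * s)) + e * s
      distribute = solve-∀

  diagonalSum-value : diagonalSum ≡ + m * + σₖ 1 m - + σₖ 2 m
  diagonalSum-value = begin
      sumTo m (λ a → + a * + a * N a a)
    ≡⟨ sum-cong m (λ a _ → trans (ℤₚ.*-assoc (+ a) (+ a) (N a a)) (trans (cong (+ a *_) (N-diagonal a))
          (trans (spread (+ a) (𝟙 (a ∣? m)) (+ m))
                 (cong₂ (λ x y → + m * (𝟙 (a ∣? m) * x) - 𝟙 (a ∣? m) * y) (sym (pos-^1 a)) (sym (pos-^2 a)))))) ⟩
      sumTo m (λ a → + m * (𝟙 (a ∣? m) * + (a ^ 1)) - 𝟙 (a ∣? m) * + (a ^ 2))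
    ≡⟨ trans (sum-− m _ _) (cong₂ _-_ (trans (sum-*ˡ m (+ m) _) (cong (+ m *_) (sym (σₖ-divisorSum 1 m′)))) (sym (σₖ-divisorSum 2 m′))) ⟩
      + m * + σₖ 1 m - + σₖ 2 m ∎
    where
    open ≡-Reasoning
    spread : ∀ a e M → a * (e * (M - a)) ≡ M * (e * a) - e * (a * a)
    spread = solve-∀

  besge : + 12 * σ-convolution ≡ + 5 * + σₖ 3 m + + σₖ 1 m - + 6 * + m * + σₖ 1 m
  besge = begin
      + 12 * σ-convolution
    ≡⟨ cong (+ 12 *_) σ-convolution≡weighted ⟩
      + 12 * weighted uv N
    ≡⟨ ℤₚ.*-assoc (+ 6) (+ 2) (weighted uv N) ⟩
      + 6 * (+ 2 * weighted uv N)
    ≡⟨ cong (+ 6 *_) weighted-uv-N ⟩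
      + 6 * (boundaryTotal - diagonalSum)
    ≡⟨ ℤₚ.*-distribˡ-+ (+ 6) boundaryTotal (- diagonalSum) ⟩
      + 6 * boundaryTotal + + 6 * - diagonalSum
    ≡⟨ cong₂ (λ x y → x + + 6 * - y) boundaryTotal-value diagonalSum-value ⟩
      (+ 5 * + σₖ 3 m - + 6 * + σₖ 2 m + + σₖ 1 m) + + 6 * - (+ m * + σₖ 1 m - + σₖ 2 m)
    ≡⟨ simplify (+ σₖ 3 m) (+ σₖ 2 m) (+ σₖ 1 m) (+ m) ⟩
      + 5 * + σₖ 3 m + + σₖ 1 m - + 6 * + m * + σₖ 1 m ∎
    where
    open ≡-Reasoning
    simplify : ∀ a b c M → (+ 5 * a - + 6 * b + c) + + 6 * - (M * c - b) ≡ + 5 * a + c - + 6 * M * c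
    simplify = solve-∀

σσ : ℕ → ℤ
σσ m = sumTo m (λ k → + σ k * + σ (m ∸ k))

besge : ∀ m → + 12 * σσ m ≡ + 5 * + σₖ 3 m + + σₖ 1 m - + 6 * + m * + σₖ 1 m
besge zero     = refl
besge (suc m′) = Besge.besge m′

-- Power series

δ : PS
δ i = 𝟙 (i ℕ.≟ 0)

⊗-identityˡ : ∀ (f : PS) n → (δ ⊗ f) n ≡ f n
⊗-identityˡ f n = sum-𝟙≟ n 0 (λ i → f (n ∸ i)) z≤n

⊗-comm : ∀ (f g : PS) n → (f ⊗ g) n ≡ (g ⊗ f) n
⊗-comm f g n = trans (sum-reflect n _) (sum-cong n (λ i i≤n →
  trans (ℤₚ.*-comm (f (n ∸ i)) _) (cong (λ j → g j * f (n ∸ i)) (ℕₚ.m∸[m∸n]≡n i≤n))))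

⊗-identityʳ : ∀ (f : PS) n → (f ⊗ δ) n ≡ f n
⊗-identityʳ f n = trans (⊗-comm f δ n) (⊗-identityˡ f n)

sum-linear₃ : ∀ n x y z (F G H : ℕ → ℤ) →
  sumTo n (λ i → x * F i + y * G i + z * H i) ≡ x * sumTo n F + y * sumTo n G + z * sumTo n H
sum-linear₃ n x y z F G H = trans (sum-+ n _ _) (cong₂ _+_ (trans (sum-+ n _ _) (cong₂ _+_ (sum-*ˡ n x F) (sum-*ˡ n y G))) (sum-*ˡ n z H))

⊗-linearʳ : ∀ x y z (f g h C F : PS) → (∀ i → C i ≡ x * f i + y * g i + z * h i) →
  ∀ n → (F ⊗ C) n ≡ x * (F ⊗ f) n + y * (F ⊗ g) n + z * (F ⊗ h) n
⊗-linearʳ x y z f g h C F C≡ n = trans (sum-cong n (λ i _ → trans (cong (F i *_) (C≡ (n ∸ i))) (spread x y z (F i) _ _ _)))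
                                      (sum-linear₃ n x y z _ _ _)
  where
  spread : ∀ x y z a p q r → a * (x * p + y * q + z * r) ≡ x * (a * p) + y * (a * q) + z * (a * r)
  spread = solve-∀

⊗-linearˡ : ∀ x y z (f g h C F : PS) → (∀ i → C i ≡ x * f i + y * g i + z * h i) →
  ∀ n → (C ⊗ F) n ≡ x * (f ⊗ F) n + y * (g ⊗ F) n + z * (h ⊗ F) n
⊗-linearˡ x y z f g h C F C≡ n = trans (⊗-comm C F n) (trans (⊗-linearʳ x y z f g h C F C≡ n)
  (cong₂ _+_ (cong₂ _+_ (cong (x *_) (⊗-comm F f n)) (cong (y *_) (⊗-comm F g n))) (cong (z *_) (⊗-comm F h n))))

L-value : ∀ j → L j ≡ δ j - + 24 * + σ j
L-value zero    = refl
L-value (suc j) = sym (ℤₚ.+-identityˡ (- (+ 24 * + σ (suc j))))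

σ/ : ℕ → PS
σ/ α i = + σₖ/ 1 i α

σₖ/-value : ∀ k i t → + σₖ/ k i (suc t) ≡ 𝟙 (suc t ∣? i) * + σₖ k (i / suc t)
σₖ/-value k i t with suc t ∣? i
... | yes _ = sym (ℤₚ.*-identityˡ _)
... | no _  = refl

/-exact : ∀ i t q → i ≡ q ℕ.* suc t → i / suc t ≡ q
/-exact .(q ℕ.* suc t) t q refl = m*n/n≡m q (suc t)

atPow-L : ∀ t i → atPow (suc t) L i ≡ δ i - + 24 * σ/ (suc t) i
atPow-L t i with suc t ∣? i
... | yes (divides q i≡qα) = trans (L-value (i / suc t)) (cong (λ z → z - + 24 * + σ (i / suc t))
      (𝟙-⇔ (i / suc t ℕ.≟ 0) (i ℕ.≟ 0)
            (λ i/α≡0 → trans i≡qα (cong (ℕ._* suc t) (trans (sym (/-exact i t q i≡qα)) i/α≡0)))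
            (λ i≡0 → trans (/-exact i t q i≡qα) (ℕₚ.m*n≡0⇒m≡0 q (suc t) (trans (sym i≡qα) i≡0)))))
... | no α∤i = sym (cong (λ z → z - + 24 * 0ℤ) (𝟙-no (i ℕ.≟ 0) (λ i≡0 → α∤i (subst (suc t ∣_) (sym i≡0) (suc t ∣0)))))

σ/-⊗-multiples : ∀ t (g : PS) n → (σ/ (suc t) ⊗ g) n ≡ sumTo n (λ x → 𝟙 (suc t ℕ.* x ≤? n) * (+ σ x * g (n ∸ suc t ℕ.* x)))
σ/-⊗-multiples t g n = trans (sum-cong n (λ i _ → trans (cong (_* g (n ∸ i)) (σₖ/-value 1 i t)) (ℤₚ.*-assoc (𝟙 (suc t ∣? i)) _ _)))
  (trans (sum-multiples t n (λ i → + σ (i / suc t) * g (n ∸ i)))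
    (sum-cong n (λ x _ → cong (λ z → 𝟙 (suc t ℕ.* x ≤? n) * (+ σ z * g (n ∸ suc t ℕ.* x))) (/-exact (suc t ℕ.* x) t x (ℕₚ.*-comm (suc t) x)))))

σ/-self-convolution : ∀ t n → (σ/ (suc t) ⊗ σ/ (suc t)) n ≡ 𝟙 (suc t ∣? n) * σσ (n / suc t)
σ/-self-convolution t n = trans (σ/-⊗-multiples t (σ/ α) n) (dilate (α ∣? n))
  where
  α = suc t
  dilate : (d : Dec (α ∣ n)) → sumTo n (λ x → 𝟙 (α ℕ.* x ≤? n) * (+ σ x * σ/ α (n ∸ α ℕ.* x))) ≡ 𝟙 d * σσ (n / α)
  dilate (no α∤n) = sum-zero n _ (λ x _ → term x (α ℕ.* x ≤? n))
    where
    term : ∀ x → (d : Dec (α ℕ.* x ≤ n)) → 𝟙 d * (+ σ x * σ/ α (n ∸ α ℕ.* x)) ≡ 0ℤ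
    term x (no _)     = refl
    term x (yes αx≤n) = trans (ℤₚ.*-identityˡ _) (trans (cong (+ σ x *_) (trans (σₖ/-value 1 (n ∸ α ℕ.* x) t)
        (𝟙*-no (α ∣? (n ∸ α ℕ.* x)) (λ α∣n-αx → α∤n (∣m∸n∣n⇒∣m α αx≤n α∣n-αx (m∣m*n x))) _))) (ℤₚ.*-zeroʳ (+ σ x)))
  dilate (yes (divides q n≡qα)) =
    trans (sum-cong n (λ x _ → term x (α ℕ.* x ≤? n) (x ≤? q)))
      (trans (sum-extend q n _ q≤n (λ x q<x → 𝟙*-no (x ≤? q) (ℕₚ.<⇒≱ q<x) _))
        (trans (sum-cong q (λ x x≤q → 𝟙*-yes (x ≤? q) x≤q _))
          (trans (cong σσ (sym (/-exact n t q n≡qα))) (sym (ℤₚ.*-identityˡ _)))))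
    where
    q≤n : q ≤ n
    q≤n = ℕₚ.≤-trans (ℕₚ.m≤m*n q α) (ℕₚ.≤-reflexive (sym n≡qα))
    term : ∀ x → (d : Dec (α ℕ.* x ≤ n)) → (e : Dec (x ≤ q)) →
      𝟙 d * (+ σ x * σ/ α (n ∸ α ℕ.* x)) ≡ 𝟙 e * (+ σ x * + σ (q ∸ x))
    term x (no _)     (no _)    = refl
    term x (yes αx≤n) (no x≰q)  =
      ⊥-elim (x≰q (ℕₚ.*-cancelʳ-≤ x q α (subst (_≤ q ℕ.* α) (ℕₚ.*-comm α x) (subst (α ℕ.* x ≤_) n≡qα αx≤n))))
    term x (no αx≰n)  (yes x≤q) =
      ⊥-elim (αx≰n (subst (α ℕ.* x ≤_) (sym n≡qα) (subst (_≤ q ℕ.* α) (ℕₚ.*-comm x α) (ℕₚ.*-monoˡ-≤ α x≤q))))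
    term x (yes αx≤n) (yes x≤q) = trans (ℤₚ.*-identityˡ _) (trans (cong (+ σ x *_) (trans (σₖ/-value 1 (n ∸ α ℕ.* x) t)
        (trans (𝟙*-yes (α ∣? (n ∸ α ℕ.* x)) (divides (q ∸ x) n-αx≡) _) (cong (λ z → + σ z) (/-exact _ t (q ∸ x) n-αx≡)))))
        (sym (ℤₚ.*-identityˡ _)))
      where
      n-αx≡ : n ∸ α ℕ.* x ≡ (q ∸ x) ℕ.* α
      n-αx≡ = trans (cong₂ _∸_ n≡qα (ℕₚ.*-comm α x)) (sym (ℕₚ.*-distribʳ-∸ α q x))

σ/-self-convolution-value : ∀ t n →
  + 12 * + suc t * (σ/ (suc t) ⊗ σ/ (suc t)) n ≡ + suc t * (+ 5 * + σₖ/ 3 n (suc t) + σ/ (suc t) n) - + 6 * + n * σ/ (suc t) n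
σ/-self-convolution-value t n =
  trans (cong (+ 12 * + α *_) (σ/-self-convolution t n))
        (trans (by-cases (α ∣? n)) (sym (cong₂ (λ a b → + α * (+ 5 * a + b) - + 6 * + n * b) (σₖ/-value 3 n t) (σₖ/-value 1 n t))))
  where
  α = suc t
  by-cases : (d : Dec (α ∣ n)) → + 12 * + α * (𝟙 d * σσ (n / α)) ≡
    + α * (+ 5 * (𝟙 d * + σₖ 3 (n / α)) + 𝟙 d * + σₖ 1 (n / α)) - + 6 * + n * (𝟙 d * + σₖ 1 (n / α))
  by-cases (no _) = zeros (+ α) (σσ (n / α)) (+ σₖ 3 (n / α)) (+ σₖ 1 (n / α)) (+ n)
    where
    zeros : ∀ a C s₃ s₁ N → + 12 * a * (0ℤ * C) ≡ a * (+ 5 * (0ℤ * s₃) + 0ℤ * s₁) - + 6 * N * (0ℤ * s₁)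
    zeros = solve-∀
  by-cases (yes (divides q n≡qα)) = begin
      + 12 * + α * (1ℤ * σσ (n / α))
    ≡⟨ cong (λ z → + 12 * + α * (1ℤ * σσ z)) (/-exact n t q n≡qα) ⟩
      + 12 * + α * (1ℤ * σσ q)
    ≡⟨ regroup (+ α) (σσ q) ⟩
      + α * (+ 12 * σσ q)
    ≡⟨ cong (+ α *_) (besge q) ⟩
      + α * (+ 5 * + σₖ 3 q + + σₖ 1 q - + 6 * + q * + σₖ 1 q)
    ≡⟨ expand (+ α) (+ σₖ 3 q) (+ σₖ 1 q) (+ q) ⟩
      + α * (+ 5 * (1ℤ * + σₖ 3 q) + 1ℤ * + σₖ 1 q) - + 6 * (+ q * + α) * (1ℤ * + σₖ 1 q)
    ≡⟨ cong₂ (λ w z → + α * (+ 5 * (1ℤ * + σₖ 3 w) + 1ℤ * + σₖ 1 w) - + 6 * z * (1ℤ * + σₖ 1 w))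
         (sym (/-exact n t q n≡qα)) (trans (sym (ℤₚ.pos-* q α)) (cong +_ (sym n≡qα))) ⟩
      + α * (+ 5 * (1ℤ * + σₖ 3 (n / α)) + 1ℤ * + σₖ 1 (n / α)) - + 6 * + n * (1ℤ * + σₖ 1 (n / α)) ∎
    where
    open ≡-Reasoning
    regroup : ∀ a C → + 12 * a * (1ℤ * C) ≡ a * (+ 12 * C)
    regroup = solve-∀
    expand : ∀ a s₃ s₁ Q → a * (+ 5 * s₃ + s₁ - + 6 * Q * s₁) ≡ a * (+ 5 * (1ℤ * s₃) + 1ℤ * s₁) - + 6 * (Q * a) * (1ℤ * s₁)
    expand = solve-∀

-- As for σₖ-summand, the left side of W-summand is the summand local to the definition of W.
mutual
  W-sum : ∀ α β n → + W α β n ≡ sumTo n (λ l → sumTo n (λ m → 𝟙 (α ℕ.* l ℕ.+ β ℕ.* m ℕ.≟ n) * (+ σ l * + σ m)))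
  W-sum α β n = trans (+-sumToℕ n _) (sum-cong n (λ l _ → trans (+-sumToℕ n _) (sum-cong n (λ m _ → W-summand α β n l m))))

  W-summand : ∀ α β n l m → _ ≡ 𝟙 (α ℕ.* l ℕ.+ β ℕ.* m ℕ.≟ n) * (+ σ l * + σ m)
  W-summand α β n l m with α ℕ.* l ℕ.+ β ℕ.* m ℕ.≟ n
  ... | yes _ = trans (ℤₚ.pos-* (σ l) (σ m)) (sym (ℤₚ.*-identityˡ _))
  ... | no _  = refl

σ/-remainder : ∀ α s n x → 𝟙 (α ℕ.* x ≤? n) * σ/ (suc s) (n ∸ α ℕ.* x) ≡ sumTo n (λ m → 𝟙 (α ℕ.* x ℕ.+ suc s ℕ.* m ℕ.≟ n) * + σ m)
σ/-remainder α s n x with α ℕ.* x ≤? n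
... | no αx≰n = sym (sum-zero n _ (λ m _ → 𝟙*-no (α ℕ.* x ℕ.+ β ℕ.* m ℕ.≟ n) (λ e → αx≰n (subst (α ℕ.* x ≤_) e (ℕₚ.m≤m+n _ _))) _))
  where
  β = suc s
... | yes αx≤n = trans (ℤₚ.*-identityˡ _) (trans (σₖ/-value 1 r s) (by-cases (β ∣? r)))
  where
  β = suc s
  r = n ∸ α ℕ.* x
  r≡ : ∀ m → α ℕ.* x ℕ.+ β ℕ.* m ≡ n → r ≡ m ℕ.* β
  r≡ m e = trans (cong (_∸ α ℕ.* x) (sym e)) (trans (ℕₚ.m+n∸m≡n (α ℕ.* x) (β ℕ.* m)) (ℕₚ.*-comm β m))
  by-cases : (d : Dec (β ∣ r)) → 𝟙 d * + σ (r / β) ≡ sumTo n (λ m → 𝟙 (α ℕ.* x ℕ.+ β ℕ.* m ℕ.≟ n) * + σ m)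
  by-cases (no β∤r) = sym (sum-zero n _ (λ m _ → 𝟙*-no (α ℕ.* x ℕ.+ β ℕ.* m ℕ.≟ n) (λ e → β∤r (divides m (r≡ m e))) _))
  by-cases (yes (divides y r≡yβ)) = trans (ℤₚ.*-identityˡ _) (sym (trans
      (sum-single n y _ y≤n (λ m _ m≢y → 𝟙*-no (α ℕ.* x ℕ.+ β ℕ.* m ℕ.≟ n) (λ e → m≢y (ℕₚ.*-cancelʳ-≡ m y β (trans (sym (r≡ m e)) r≡yβ))) _))
      (trans (𝟙*-yes (α ℕ.* x ℕ.+ β ℕ.* y ℕ.≟ n) hit _) (cong (λ z → + σ z) (sym (/-exact r s y r≡yβ))))))
    where
    y≤n : y ≤ n
    y≤n = ℕₚ.≤-trans (ℕₚ.m≤m*n y β) (ℕₚ.≤-trans (ℕₚ.≤-reflexive (sym r≡yβ)) (ℕₚ.m∸n≤m n (α ℕ.* x)))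
    hit : α ℕ.* x ℕ.+ β ℕ.* y ≡ n
    hit = trans (cong (α ℕ.* x ℕ.+_) (trans (ℕₚ.*-comm β y) (sym r≡yβ))) (ℕₚ.m+[n∸m]≡n αx≤n)

σ/-cross-convolution : ∀ t s n → (σ/ (suc t) ⊗ σ/ (suc s)) n ≡ + W (suc t) (suc s) n
σ/-cross-convolution t s n = trans (σ/-⊗-multiples t (σ/ (suc s)) n) (trans (sum-cong n (λ x _ → term x)) (sym (W-sum (suc t) (suc s) n)))
  where
  α = suc t
  swap-front : ∀ a b c → a * (b * c) ≡ b * (a * c)
  swap-front = solve-∀
  term : ∀ x → 𝟙 (α ℕ.* x ≤? n) * (+ σ x * σ/ (suc s) (n ∸ α ℕ.* x))
             ≡ sumTo n (λ m → 𝟙 (α ℕ.* x ℕ.+ suc s ℕ.* m ℕ.≟ n) * (+ σ x * + σ m))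
  term x = trans (swap-front (𝟙 (α ℕ.* x ≤? n)) (+ σ x) _) (trans (cong (+ σ x *_) (σ/-remainder α s n x))
             (trans (sym (sum-*ˡ n (+ σ x) _)) (sum-cong n (λ m _ → swap-front (+ σ x) (𝟙 (α ℕ.* x ℕ.+ suc s ℕ.* m ℕ.≟ n)) (+ σ m)))))

⊗-square-δ : ∀ x y z (g h C : PS) → (∀ i → C i ≡ x * δ i + y * g i + z * h i) → ∀ n →
  (C ⊗ C) n ≡ x * x * δ n + + 2 * x * y * g n + + 2 * x * z * h n
            + y * y * (g ⊗ g) n + + 2 * y * z * (g ⊗ h) n + z * z * (h ⊗ h) n
⊗-square-δ x y z g h C C≡ n = begin
    (C ⊗ C) n
  ≡⟨ ⊗-linearˡ x y z δ g h C C C≡ n ⟩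
    x * (δ ⊗ C) n + y * (g ⊗ C) n + z * (h ⊗ C) n
  ≡⟨ cong₂ _+_ (cong₂ _+_ (cong (x *_) (trans (⊗-identityˡ C n) (C≡ n))) (cong (y *_) (⊗-linearʳ x y z δ g h C g C≡ n)))
               (cong (z *_) (⊗-linearʳ x y z δ g h C h C≡ n)) ⟩
    x * (x * δ n + y * g n + z * h n) + y * (x * (g ⊗ δ) n + y * (g ⊗ g) n + z * (g ⊗ h) n)
      + z * (x * (h ⊗ δ) n + y * (h ⊗ g) n + z * (h ⊗ h) n)
  ≡⟨ cong₂ (λ p q → x * (x * δ n + y * g n + z * h n) + y * (x * p + y * (g ⊗ g) n + z * (g ⊗ h) n) + z * q)
           (⊗-identityʳ g n) (cong₂ (λ p q → x * p + y * q + z * (h ⊗ h) n) (⊗-identityʳ h n) (⊗-comm h g n)) ⟩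
    x * (x * δ n + y * g n + z * h n) + y * (x * g n + y * (g ⊗ g) n + z * (g ⊗ h) n)
      + z * (x * h n + y * (g ⊗ h) n + z * (h ⊗ h) n)
  ≡⟨ collect x y z (δ n) (g n) (h n) ((g ⊗ g) n) ((g ⊗ h) n) ((h ⊗ h) n) ⟩
    x * x * δ n + + 2 * x * y * g n + + 2 * x * z * h n + y * y * (g ⊗ g) n + + 2 * y * z * (g ⊗ h) n + z * z * (h ⊗ h) n ∎
  where
  open ≡-Reasoning
  collect : ∀ x y z d p q pp pq qq →
    x * (x * d + y * p + z * q) + y * (x * p + y * pp + z * pq) + z * (x * q + y * pq + z * qq)
      ≡ x * x * d + + 2 * x * y * p + + 2 * x * z * q + y * y * pp + + 2 * y * z * pq + z * z * qq
  collect = solve-∀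

atPow-difference : ∀ t s i → ((+ suc t · atPow (suc t) L) ⊖ (+ suc s · atPow (suc s) L)) i
  ≡ (+ suc t - + suc s) * δ i + - + 24 * + suc t * σ/ (suc t) i + + 24 * + suc s * σ/ (suc s) i
atPow-difference t s i = trans (cong₂ (λ p q → + suc t * p - + suc s * q) (atPow-L t i) (atPow-L s i))
                               (regroup (+ suc t) (+ suc s) (δ i) (σ/ (suc t) i) (σ/ (suc s) i))
  where
  regroup : ∀ a b d p q → a * (d - + 24 * p) - b * (d - + 24 * q) ≡ (a - b) * d + - + 24 * a * p + + 24 * b * q
  regroup = solve-∀

-- The left side is the coefficient of q^n, n ≥ 1, in (a(1 − 24A) − b(1 − 24B))² as expanded
-- by ⊗-square-δ; the first two hypotheses are Besge's formula for A⊗A and B⊗B.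
coefficient-identity : ∀ a b n A B A₃ B₃ AA BB AB X →
  + 12 * a * AA ≡ a * (+ 5 * A₃ + A) - + 6 * n * A →
  + 12 * b * BB ≡ b * (+ 5 * B₃ + B) - + 6 * n * B →
  AB ≡ X →
  let x = a - b ; y = - + 24 * a ; z = + 24 * b in
  x * x * 0ℤ + + 2 * x * y * A + + 2 * x * z * B + y * y * AA + + 2 * y * z * AB + z * z * BB
    ≡ + 240 * (a * a) * A₃ + + 240 * (b * b) * B₃ + + 48 * a * (b - + 6 * n) * A + + 48 * b * (a - + 6 * n) * B
      - + 1152 * a * b * X
coefficient-identity a b n A B A₃ B₃ AA BB AB X hA hB refl =
  ℤₚ.i-j≡0⇒i≡j _ _ (trans (difference a b n A B A₃ B₃ AA BB AB)
    (trans (cong₂ (λ p q → + 48 * a * p + + 48 * b * q) (ℤₚ.i≡j⇒i-j≡0 hA) (ℤₚ.i≡j⇒i-j≡0 hB)) (vanish a b)))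
  where
  difference : ∀ a b n A B A₃ B₃ AA BB AB →
    let x = a - b ; y = - + 24 * a ; z = + 24 * b in
    (x * x * 0ℤ + + 2 * x * y * A + + 2 * x * z * B + y * y * AA + + 2 * y * z * AB + z * z * BB)
      - (+ 240 * (a * a) * A₃ + + 240 * (b * b) * B₃ + + 48 * a * (b - + 6 * n) * A + + 48 * b * (a - + 6 * n) * B
         - + 1152 * a * b * AB)
    ≡ + 48 * a * (+ 12 * a * AA - (a * (+ 5 * A₃ + A) - + 6 * n * A))
      + + 48 * b * (+ 12 * b * BB - (b * (+ 5 * B₃ + B) - + 6 * n * B))
  difference = solve-∀
  vanish : ∀ a b → + 48 * a * 0ℤ + + 48 * b * 0ℤ ≡ 0ℤ
  vanish = solve-∀

theorem2p4 : (α β : ℕ) → 1 ≤ α → α < β → Coprime α β →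
    ∀ n → (((+ α · atPow α L) ⊖ (+ β · atPow β L)) ⊗ ((+ α · atPow α L) ⊖ (+ β · atPow β L))) n
          ≡ rhs α β n
theorem2p4 (suc t) (suc s) _ _ _ zero    = constant-term (+ suc t) (+ suc s)
  where
  -- atPow α L 0 computes to L 0 = 1.
  constant-term : ∀ a b → (a * + 1 - b * + 1) * (a * + 1 - b * + 1) ≡ (a - b) * (a - b)
  constant-term = solve-∀
theorem2p4 (suc t) (suc s) _ _ _ (suc n) =
  trans (⊗-square-δ (a - b) (- + 24 * a) (+ 24 * b) (σ/ α) (σ/ β) C (atPow-difference t s) m)
  (trans (coefficient-identity a b (+ m) (σ/ α m) (σ/ β m) (+ σₖ/ 3 m α) (+ σₖ/ 3 m β)
            ((σ/ α ⊗ σ/ α) m) ((σ/ β ⊗ σ/ β) m) ((σ/ α ⊗ σ/ β) m) (+ W α β m)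
            (σ/-self-convolution-value t m) (σ/-self-convolution-value s m) (σ/-cross-convolution t s m))
         (cong₂ (λ a² b² → + 240 * a² * + σₖ/ 3 m α + + 240 * b² * + σₖ/ 3 m β + + 48 * a * (b - + 6 * + m) * σ/ α m
                          + + 48 * b * (a - + 6 * + m) * σ/ β m - + 1152 * a * b * + W α β m)
                (sym (pos-^2 α)) (sym (pos-^2 β))))
  where
  α = suc t
  β = suc s
  m = suc n
  a = + α
  b = + β
  C : PS
  C = (+ α · atPow α L) ⊖ (+ β · atPow β L)
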